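{- Fix an integer $k\ge 0$ and let $r\ge \max(k,1)$. Let $a_N=(N-1)!$ for $N\ge 1$ and let $\delta$ be the difference operator on sequences, $(\delta a)_N=a_N-a_{N-1}$. Then $u_{r+k,r}=(\delta^k a)_{r+k}$. In particular, if moreover $k\ge 1$, then $u_{r+k,r}=u_{r+k,r+1}-u_{r+k-1,r}$.
   Context: The Turán graph $T(n,r)$ ($1\le r\le n$) is the complete $r$-partite graph on $n$ vertices whose part sizes are all $\lceil n/r\rceil$ or $\lfloor n/r\rfloor$; two vertices are adjacent iff in different parts. $u_{n,r}$ denotes the number of acyclic orientations of $T(n,r)$ with a unique sink equal to a fixed vertex $s$ (this number is independent of $s$). An acyclic orientation directs all edges without a directed cycle; a sink is a vertex with no outgoing edge. -}

module Defs where

open import Data.Nat using (ℕ; zero; suc; _∸_; NonZero; _!)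
open import Data.Nat.DivMod using (_%_)

open import Data.Integer using (ℤ; +_; _-_)
open import Data.Fin using (Fin; toℕ)
open import Data.Bool using (Bool; T)
open import Data.Vec using (Vec; lookup)
open import Data.List using (List; length)
open import Data.List.Membership.Propositional using (_∈_)
open import Data.List.Relation.Unary.Unique.Propositional using (Unique)
open import Data.Product using (Σ; _×_)
open import Data.Sum using (_⊎_)
open import Relation.Nullary using (¬_)
open import Relation.Binary.PropositionalEquality using (_≡_)
open import Function.Bundles using (_⇔_)

-- Turán graph T(n,r) on vertex set Fin n (r ≥ 1): vertex i lies in part
-- (i mod r); the parts then have sizes ⌈n/r⌉ or ⌊n/r⌋.
-- Two vertices are adjacent iff they lie in different parts.

TuranAdj : (n r : ℕ) .{{_ : NonZero r}} → Fin n → Fin n → Set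
TuranAdj n r i j = ¬ (toℕ i % r ≡ toℕ j % r)

-- A (partial) orientation as an n×n Boolean matrix: arc o i j = true
-- means there is a directed edge i → j.

Matrix : ℕ → Set
Matrix n = Vec (Vec Bool n) n

arc : {n : ℕ} → Matrix n → Fin n → Fin n → Bool
arc o i j = lookup (lookup o i) j

IsOrientation : (n r : ℕ) .{{_ : NonZero r}} → Matrix n → Set
IsOrientation n r o =
  (∀ i j → T (arc o i j) → TuranAdj n r i j) ×
  (∀ i j → TuranAdj n r i j → T (arc o i j) ⊎ T (arc o j i)) ×
  (∀ i j → ¬ (T (arc o i j) × T (arc o j i)))

data Walk {n : ℕ} (o : Matrix n) : Fin n → Fin n → Set where
  here : ∀ {i} → Walk o i i
  step : ∀ {i j k} → T (arc o i j) → Walk o j k → Walk o i k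

-- a directed cycle exists iff there is a closed directed walk of
-- positive length
HasDirectedCycle : {n : ℕ} → Matrix n → Set
HasDirectedCycle {n} o =
  Σ (Fin n) λ i → Σ (Fin n) λ j → T (arc o i j) × Walk o j i

IsAcyclic : {n : ℕ} → Matrix n → Set
IsAcyclic o = ¬ HasDirectedCycle o

IsSink : {n : ℕ} → Matrix n → Fin n → Set
IsSink {n} o v = ∀ (j : Fin n) → ¬ T (arc o v j)

AcyclicUniqueSink : (n r : ℕ) .{{_ : NonZero r}} → Fin n → Matrix n → Set
AcyclicUniqueSink n r s o =
  IsOrientation n r o × IsAcyclic o × IsSink o s ×
  (∀ v → IsSink o v → v ≡ s)

-- "P has exactly m elements": a duplicate-free list enumerating P,
-- of length m.

HasCount : {A : Set} → (A → Set) → ℕ → Set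
HasCount {A} P m =
  Σ (List A) λ xs → Unique xs × (∀ x → (x ∈ xs) ⇔ P x) × length xs ≡ m

IsU : (n r : ℕ) .{{_ : NonZero r}} → ℕ → Set
IsU n r m = ∀ (s : Fin n) → HasCount (AcyclicUniqueSink n r s) m

-- a_N = (N-1)!  (the value at N = 0 is junk and never used)

a : ℕ → ℤ
a N = + ((N ∸ 1) !)

-- difference operator (δ b)_N = b_N - b_{N-1}  (junk at N = 0)
δ : (ℕ → ℤ) → (ℕ → ℤ)
δ b N = b N - b (N ∸ 1)

δ^ : ℕ → (ℕ → ℤ) → (ℕ → ℤ)
δ^ zero b = b
δ^ (suc k) b = δ (δ^ k b)

-- For non-adjacent twins x, y of a graph G (same neighbourhood), split the acyclic orientations of
-- G + xy with unique sink s ≠ y according to whether y is a clone of x with the arc y → x.  Those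
-- are exactly the orientations of G − y with y re-inserted as such a clone; the others correspond,
-- by deleting the edge xy, to the orientations of G (the edge is put back as x → y unless a path
-- y → z → x would turn it into a cycle).  Hence u(G) = u(G + xy) − u(G − y): deletion–contraction,
-- with G/xy ≅ G − y.
--
-- For k ≤ r, T(r + k, r) is K_{r+k} minus the k disjoint edges {a, r + a}, a < k.  Removing these
-- edges one at a time, and deleting whichever endpoint of the last pair is not the sink, lands
-- again in this family on one vertex fewer, so u = δ^k applied to u(K_N) = (N − 1)!, which in
-- turn follows by deleting the source of an acyclic tournament.

module Submission where

open import Defs
open import Level using (0ℓ)
open import Data.Nat using (ℕ; zero; suc; _+_; _*_; _∸_; _≤_; _<_; _!; NonZero; z≤n; s≤s; s<s⁻¹; s≤s⁻¹; _<?_)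
open import Data.Nat.Properties as ℕ
  using ( ≤-refl; ≤-trans; <-trans; ≤-<-trans; <-≤-trans; <-irrefl; <⇒≤; ≮⇒≥; n≤1+n; m≤m+n; m≤n+m; m<n+m
        ; m<n⇒m<1+n; m<1+n⇒m<n∨m≡n; suc-injective; +-comm; +-suc; +-monoʳ-≤; +-monoʳ-<; +-cancelˡ-≡; +-cancelˡ-<
        ; m+n∸n≡m; m+[n∸m]≡n)
open import Data.Nat.DivMod using (_%_; [m+n]%n≡m%n; m<n⇒m%n≡m)
open import Data.Integer using (ℤ; +_; _-_)
import Data.Integer.Properties as ℤ
open import Data.Bool using (Bool; true; false; T; not; _∨_)
import Data.Bool.Properties as Bool
open import Data.Maybe using (Maybe; nothing; just; fromMaybe)
open import Data.Product using (Σ; ∃; _×_; _,_; proj₁; proj₂)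
import Data.Product as Product
open import Data.Sum using (_⊎_; inj₁; inj₂; [_,_]′)
import Data.Sum as Sum
open import Data.Sum.Function.Propositional using (_⊎-⇔_)
open import Data.Empty using (⊥; ⊥-elim)
open import Data.Fin using (Fin; zero; suc; toℕ; fromℕ<; punchIn; punchOut; _≟_)
open import Data.Fin.Properties as Fin
  using ( 0≢1+n; toℕ<n; toℕ-injective; toℕ-fromℕ<; punchInᵢ≢i; punchIn-injective; punchOut-cong; punchOut-punchIn
        ; punchIn-punchOut; any?; all?)
open import Data.Vec using ([]; _∷_; tabulate; lookup)
open import Data.Vec.Properties using (lookup∘tabulate; tabulate∘lookup; tabulate-cong)
open import Data.List using (List; []; _∷_; length; map; filter; _++_)
open import Data.List.Properties using (length-map; length-++)
open import Data.List.Membership.Propositional using (_∈_)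
open import Data.List.Membership.Propositional.Properties using (∈-map⁺; ∈-map⁻; ∈-filter⁺; ∈-filter⁻; ++-∈⇔)
open import Data.List.Membership.Propositional.Properties.WithK using (unique∧set⇒bag)
open import Data.List.Relation.Binary.BagAndSetEquality using (∼bag⇒↭)
open import Data.List.Relation.Binary.Permutation.Propositional.Properties using (↭-length)
open import Data.List.Relation.Unary.All as All using (All; []; _∷_)
open import Data.List.Relation.Unary.AllPairs using ([]; _∷_)
open import Data.List.Relation.Unary.Any using (here)
open import Data.List.Relation.Unary.Unique.Propositional using (Unique)
import Data.List.Relation.Unary.Unique.Propositional.Properties as Unique
open import Function using (_∘_; _∘₂_; id; const; case_of_)
open import Function.Bundles using (_⇔_; mk⇔; Equivalence)
open import Function.Properties.Equivalence using () renaming (trans to ⇔-trans; sym to ⇔-sym)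
open import Relation.Binary using (Rel)
open import Relation.Binary.Construct.Closure.ReflexiveTransitive using (Star; ε; _◅_; _◅◅_; gmap)
open import Relation.Nullary using (¬_; Dec; does; yes; no; ¬?)
open import Relation.Nullary.Decidable using (_×-dec_; _⊎-dec_; _→-dec_; T?; dec-true; dec-false; decidable-stable)
open import Relation.Unary using (Pred; Decidable; _∩_; ∁)
open import Relation.Binary.PropositionalEquality

open Equivalence using (to; from)
open ≡-Reasoning

-- Counting

private
  variable
    A B : Set
    P Q : Pred A 0ℓ
    m n : ℕ

HasCount-unique : HasCount P m → HasCount P n → m ≡ n
HasCount-unique (xs , xs! , xs∈ , refl) (ys , ys! , ys∈ , refl) =
  ↭-length (∼bag⇒↭ (unique∧set⇒bag xs! ys! λ {x} → ⇔-trans (xs∈ x) (⇔-sym (ys∈ x))))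

HasCount-cong : (∀ x → P x ⇔ Q x) → HasCount P m → HasCount Q m
HasCount-cong P⇔Q (xs , xs! , xs∈ , len) = xs , xs! , (λ x → ⇔-trans (xs∈ x) (P⇔Q x)) , len

HasCount-⊎ : HasCount P m → HasCount Q n → (∀ {x} → P x → ¬ Q x) →
             HasCount (λ x → P x ⊎ Q x) (m + n)
HasCount-⊎ (xs , xs! , xs∈ , refl) (ys , ys! , ys∈ , refl) disjoint =
  xs ++ ys ,
  Unique.++⁺ xs! ys! (λ (x∈xs , x∈ys) → disjoint (to (xs∈ _) x∈xs) (to (ys∈ _) x∈ys)) ,
  (λ x → ⇔-trans ++-∈⇔ (xs∈ x ⊎-⇔ ys∈ x)) ,
  length-++ xs

HasCount-filter : Decidable Q → HasCount P m → Σ ℕ λ k → HasCount (P ∩ Q) k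
HasCount-filter Q? (xs , xs! , xs∈ , _) =
  length (filter Q? xs) , filter Q? xs , Unique.filter⁺ Q? xs! ,
  (λ x → mk⇔ (λ x∈ → let (x∈xs , q) = ∈-filter⁻ Q? x∈ in to (xs∈ x) x∈xs , q)
             (λ (p , q) → ∈-filter⁺ Q? (from (xs∈ x) p) q)) ,
  refl

HasCount-split : Decidable Q → HasCount P m →
  Σ ℕ λ k → Σ ℕ λ l → HasCount (P ∩ Q) k × HasCount (P ∩ ∁ Q) l × k + l ≡ m
HasCount-split {Q = Q} {P = P} Q? hP with HasCount-filter Q? hP | HasCount-filter (¬? ∘ Q?) hP
... | k , hPQ | l , hP¬Q = k , l , hPQ , hP¬Q ,
  HasCount-unique (HasCount-cong ⊎⇔P (HasCount-⊎ hPQ hP¬Q λ (_ , q) (_ , ¬q) → ¬q q)) hP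
  where
  ⊎⇔P : ∀ x → ((P ∩ Q) x ⊎ (P ∩ ∁ Q) x) ⇔ P x
  ⊎⇔P x = mk⇔ [ proj₁ , proj₁ ]′ λ p → case Q? x of λ where
    (yes q) → inj₁ (p , q)
    (no ¬q) → inj₂ (p , ¬q)

map-Unique-on : (f : A → B) → (∀ {a b} → P a → P b → f a ≡ f b → a ≡ b) →
                ∀ {xs} → All P xs → Unique xs → Unique (map f xs)
map-Unique-on f inj [] [] = []
map-Unique-on {P = P} f inj {x ∷ _} (px ∷ pxs) (x∉xs ∷ xs!) =
  images-differ pxs x∉xs ∷ map-Unique-on f inj pxs xs!
  where
  images-differ : ∀ {ys} → All P ys → All (x ≢_) ys → All (f x ≢_) (map f ys)
  images-differ [] [] = []
  images-differ (py ∷ pys) (x≢y ∷ x≢ys) = (x≢y ∘ inj px py) ∷ images-differ pys x≢ys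

HasCount-bijection : (f : A → B) (g : B → A) →
  (∀ {a} → P a → Q (f a)) → (∀ {b} → Q b → P (g b)) →
  (∀ {b} → Q b → f (g b) ≡ b) → (∀ {a} → P a → g (f a) ≡ a) →
  HasCount P m → HasCount Q m
HasCount-bijection {Q = Q} f g P⇒Q Q⇒P fg gf (xs , xs! , xs∈ , len) =
  map f xs ,
  map-Unique-on f (λ pa pb fa≡fb → trans (sym (gf pa)) (trans (cong g fa≡fb) (gf pb)))
    (All.tabulate λ {a} a∈ → to (xs∈ a) a∈) xs! ,
  (λ b → mk⇔ (λ b∈ → let (a , a∈ , b≡fa) = ∈-map⁻ f b∈ in subst Q (sym b≡fa) (P⇒Q (to (xs∈ a) a∈)))
             (λ qb → subst (_∈ map f xs) (fg qb) (∈-map⁺ f (from (xs∈ (g b)) (Q⇒P qb))))) ,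
  trans (length-map f xs) len

HasCount-Σ-Fin : (P : Fin m → Pred A _) → (∀ t → HasCount (P t) n) →
  (∀ {t t' x} → P t x → P t' x → t ≡ t') →
  HasCount (λ x → Σ (Fin m) λ t → P t x) (m * n)
HasCount-Σ-Fin {m = zero} P _ _ = [] , [] , (λ _ → mk⇔ (λ ()) (λ ())) , refl
HasCount-Σ-Fin {m = suc m} P count disjoint =
  HasCount-cong (λ x → mk⇔ [ (zero ,_) , (λ (t , p) → suc t , p) ]′ split)
    (HasCount-⊎ (count zero) (HasCount-Σ-Fin (P ∘ suc) (count ∘ suc) (Fin.suc-injective ∘₂ disjoint))
      (λ p (_ , q) → 0≢1+n (disjoint p q)))
  where
  split : ∀ {x} → Σ (Fin (suc m)) (λ t → P t x) → P zero x ⊎ Σ (Fin m) (λ t → P (suc t) x)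
  split (zero , p) = inj₁ p
  split (suc t , p) = inj₂ (t , p)

-- Orientations, walks and adjacency matrices

¬T⇒≡false : ∀ {b} → ¬ T b → b ≡ false
¬T⇒≡false {false} _ = refl
¬T⇒≡false {true} ¬t = ⊥-elim (¬t _)

T-ext : ∀ {a b} → (T a → T b) → (T b → T a) → a ≡ b
T-ext {false} {false} _ _ = refl
T-ext {false} {true} _ b⇒a = ⊥-elim (b⇒a _)
T-ext {true} {false} a⇒b _ = ⊥-elim (a⇒b _)
T-ext {true} {true} _ _ = refl

T⊎T⇒≡not : ∀ {a b} → T a ⊎ T b → ¬ (T a × T b) → a ≡ not b
T⊎T⇒≡not {true} {true} _ ¬both = ⊥-elim (¬both _)
T⊎T⇒≡not {true} {false} _ _ = refl
T⊎T⇒≡not {false} {true} _ _ = refl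
T⊎T⇒≡not {false} {false} (inj₁ ()) _
T⊎T⇒≡not {false} {false} (inj₂ ()) _

T-does⇒ : {A : Set} (a? : Dec A) → T (does a?) → A
T-does⇒ (yes a) _ = a

Graph : ℕ → Set₁
Graph n = Rel (Fin n) 0ℓ

Arc : Matrix n → Graph n
Arc o i j = T (arc o i j)

Orients : Graph n → Matrix n → Set
Orients G o =
  (∀ i j → Arc o i j → G i j) ×
  (∀ i j → G i j → Arc o i j ⊎ Arc o j i) ×
  (∀ i j → ¬ (Arc o i j × Arc o j i))

-- For G = TuranAdj n r this unfolds to AcyclicUniqueSink n r s o.
UniqueSinkAO : Graph n → Fin n → Matrix n → Set
UniqueSinkAO G s o = Orients G o × IsAcyclic o × IsSink o s × (∀ v → IsSink o v → v ≡ s)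

Acyclic : Graph n → Set
Acyclic R = ∀ {i j} → R i j → ¬ Star R j i

module _ {o : Matrix n} where

  walk⇒star : ∀ {i j} → Walk o i j → Star (Arc o) i j
  walk⇒star here = ε
  walk⇒star (step p w) = p ◅ walk⇒star w

  star⇒walk : ∀ {i j} → Star (Arc o) i j → Walk o i j
  star⇒walk ε = here
  star⇒walk (p ◅ w) = step p (star⇒walk w)

  IsAcyclic⇒Acyclic : IsAcyclic o → Acyclic (Arc o)
  IsAcyclic⇒Acyclic acyclic p w = acyclic (_ , _ , p , star⇒walk w)

  Acyclic⇒IsAcyclic : Acyclic (Arc o) → IsAcyclic o
  Acyclic⇒IsAcyclic acyclic (_ , _ , p , w) = acyclic p (walk⇒star w)

module AO {G : Graph n} {s : Fin n} {o : Matrix n} (h : UniqueSinkAO G s o) where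

  arc⇒edge : ∀ i j → Arc o i j → G i j
  arc⇒edge = proj₁ (proj₁ h)

  edge⇒arc : ∀ i j → G i j → Arc o i j ⊎ Arc o j i
  edge⇒arc = proj₁ (proj₂ (proj₁ h))

  antisym : ∀ i j → Arc o i j → ¬ Arc o j i
  antisym i j p q = proj₂ (proj₂ (proj₁ h)) i j (p , q)

  acyclic : Acyclic (Arc o)
  acyclic = IsAcyclic⇒Acyclic (proj₁ (proj₂ h))

  sink : IsSink o s
  sink = proj₁ (proj₂ (proj₂ h))

  sink-unique : ∀ v → IsSink o v → v ≡ s
  sink-unique = proj₂ (proj₂ (proj₂ h))

  arc⇒≢ : (∀ i → ¬ G i i) → ∀ {i j} → Arc o i j → i ≢ j
  arc⇒≢ irrefl {i} p refl = irrefl i (arc⇒edge i i p)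

UniqueSinkAO-cong : {G H : Graph n} {s : Fin n} → (∀ i j → G i j ⇔ H i j) →
                    ∀ o → UniqueSinkAO G s o ⇔ UniqueSinkAO H s o
UniqueSinkAO-cong G⇔H o = mk⇔ (transport G⇔H) (transport (λ i j → ⇔-sym (G⇔H i j)))
  where
  transport : ∀ {G H s} → (∀ i j → G i j ⇔ H i j) → UniqueSinkAO G s o → UniqueSinkAO H s o
  transport G⇔H ((arc⇒G , G⇒arc , anti) , rest) =
    ((λ i j → to (G⇔H i j) ∘ arc⇒G i j) , (λ i j → G⇒arc i j ∘ from (G⇔H i j)) , anti) , rest

first-step : ∀ {R : Graph n} {u v} → u ≢ v → Star R u v → ∃ λ w → R u w × Star R w v
first-step u≢v ε = ⊥-elim (u≢v refl)
first-step _ (p ◅ w) = _ , p , w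

Acyclic-comap : ∀ {m} {R : Graph n} {S : Graph m} (φ : Fin n → Fin m) →
                (∀ {i j} → R i j → S (φ i) (φ j)) → Acyclic S → Acyclic R
Acyclic-comap φ hom acyclic p w = acyclic (hom p) (gmap φ hom w)

module _ {m} {R : Graph (suc n)} {S : Graph m} (φ : Fin (suc n) → Fin m) (t : Fin (suc n))
         (nothing-into-t : ∀ {i} → ¬ R i t) (hom : ∀ {i j} → R i j → i ≢ t → S (φ i) (φ j)) where

  private
    reaches-t : ∀ {j} → Star R j t → j ≡ t
    reaches-t ε = refl
    reaches-t (p ◅ w) with reaches-t w
    ... | refl = ⊥-elim (nothing-into-t p)

    lift : ∀ {u v} → u ≢ t → Star R u v → Star S (φ u) (φ v)
    lift _ ε = ε
    lift u≢t (p ◅ w) = hom p u≢t ◅ lift (λ { refl → nothing-into-t p }) w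

  Acyclic-addSource : Acyclic S → Acyclic R
  Acyclic-addSource acyclic {i} p w with i ≟ t
  ... | yes refl = nothing-into-t (subst (R i) (reaches-t w) p)
  ... | no i≢t = acyclic (hom p i≢t) (lift (λ { refl → nothing-into-t p }) w)

module _ {R R⁺ : Graph n} {a b : Fin n} (acyclic : Acyclic R) (no-b⇝a : ¬ Star R b a)
         (R⁺⊆R+ab : ∀ {i j} → R⁺ i j → R i j ⊎ (i ≡ a × j ≡ b)) where

  private
    through-ab : ∀ {u v} → Star R⁺ u v → Star R u v ⊎ (Star R u a × Star R b v)
    through-ab ε = inj₁ ε
    through-ab (p ◅ w) with R⁺⊆R+ab p | through-ab w
    ... | inj₁ q | inj₁ w′ = inj₁ (q ◅ w′)
    ... | inj₁ q | inj₂ (w₁ , w₂) = inj₂ (q ◅ w₁ , w₂)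
    ... | inj₂ (refl , refl) | inj₁ w′ = inj₂ (ε , w′)
    ... | inj₂ (refl , refl) | inj₂ (w₁ , _) = ⊥-elim (no-b⇝a w₁)

  Acyclic-addArc : Acyclic R⁺
  Acyclic-addArc p w with R⁺⊆R+ab p | through-ab w
  ... | inj₁ q | inj₁ w′ = acyclic q w′
  ... | inj₁ q | inj₂ (w₁ , w₂) = no-b⇝a (w₂ ◅◅ q ◅ w₁)
  ... | inj₂ (refl , refl) | inj₁ w′ = no-b⇝a w′
  ... | inj₂ (refl , refl) | inj₂ (w₁ , _) = no-b⇝a w₁

matrix : (Fin n → Fin n → Bool) → Matrix n
matrix f = tabulate λ i → tabulate (f i)

arc-matrix : ∀ (f : Fin n → Fin n → Bool) i j → arc (matrix f) i j ≡ f i j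
arc-matrix f i j rewrite lookup∘tabulate (λ i → tabulate (f i)) i = lookup∘tabulate (f i) j

matrix-ext : (o p : Matrix n) → (∀ i j → arc o i j ≡ arc p i j) → o ≡ p
matrix-ext o p o≗p = begin
  o                  ≡⟨ sym (tabulate∘lookup o) ⟩
  tabulate (lookup o) ≡⟨ tabulate-cong (λ i → trans (sym (tabulate∘lookup (lookup o i)))
                                                    (trans (tabulate-cong (o≗p i)) (tabulate∘lookup (lookup p i)))) ⟩
  tabulate (lookup p) ≡⟨ tabulate∘lookup p ⟩
  p                  ∎

data PunchInView (t : Fin (suc n)) : Fin (suc n) → Set where
  at      : PunchInView t t
  punched : (i : Fin n) → PunchInView t (punchIn t i)

punchInView : (t v : Fin (suc n)) → PunchInView t v
punchInView t v with v ≟ t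
... | yes refl = at
... | no v≢t = subst (PunchInView t) (punchIn-punchOut (v≢t ∘ sym)) (punched _)

punchOut? : (t v : Fin (suc n)) → Maybe (Fin n)
punchOut? t v with v ≟ t
... | yes _ = nothing
... | no v≢t = just (punchOut (v≢t ∘ sym))

punchOut?-self : (t : Fin (suc n)) → punchOut? t t ≡ nothing
punchOut?-self t with t ≟ t
... | yes _ = refl
... | no t≢t = ⊥-elim (t≢t refl)

punchOut?-punchIn : (t : Fin (suc n)) (i : Fin n) → punchOut? t (punchIn t i) ≡ just i
punchOut?-punchIn t i with punchIn t i ≟ t
... | yes eq = ⊥-elim (punchInᵢ≢i t i eq)
... | no _ = cong just (trans (punchOut-cong t refl) (punchOut-punchIn t))

insertEntry : (out into : Fin n → Bool) → Matrix n → Maybe (Fin n) → Maybe (Fin n) → Bool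
insertEntry out into o nothing nothing = false
insertEntry out into o nothing (just j) = out j
insertEntry out into o (just i) nothing = into i
insertEntry out into o (just i) (just j) = arc o i j

-- The new vertex t gets arcs t → punchIn t j iff out j, and punchIn t i → t iff into i.
insertVertex : (t : Fin (suc n)) (out into : Fin n → Bool) → Matrix n → Matrix (suc n)
insertVertex t out into o = matrix λ i j → insertEntry out into o (punchOut? t i) (punchOut? t j)

deleteVertex : Fin (suc n) → Matrix (suc n) → Matrix n
deleteVertex t o = matrix λ i j → arc o (punchIn t i) (punchIn t j)

arc-deleteVertex : ∀ t (o : Matrix (suc n)) i j → arc (deleteVertex t o) i j ≡ arc o (punchIn t i) (punchIn t j)
arc-deleteVertex t o = arc-matrix _

module _ (t : Fin (suc n)) (out into : Fin n → Bool) (o : Matrix n) where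

  private
    arc-insert : ∀ {i j mi mj} → punchOut? t i ≡ mi → punchOut? t j ≡ mj →
                 arc (insertVertex t out into o) i j ≡ insertEntry out into o mi mj
    arc-insert {i} {j} refl refl = arc-matrix (λ i j → insertEntry out into o (punchOut? t i) (punchOut? t j)) i j

  arc-insert-self : arc (insertVertex t out into o) t t ≡ false
  arc-insert-self = arc-insert (punchOut?-self t) (punchOut?-self t)

  arc-insert-out : ∀ j → arc (insertVertex t out into o) t (punchIn t j) ≡ out j
  arc-insert-out j = arc-insert (punchOut?-self t) (punchOut?-punchIn t j)

  arc-insert-into : ∀ i → arc (insertVertex t out into o) (punchIn t i) t ≡ into i
  arc-insert-into i = arc-insert (punchOut?-punchIn t i) (punchOut?-self t)

  arc-insert-punchIn : ∀ i j → arc (insertVertex t out into o) (punchIn t i) (punchIn t j) ≡ arc o i j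
  arc-insert-punchIn i j = arc-insert (punchOut?-punchIn t i) (punchOut?-punchIn t j)

  deleteVertex-insertVertex : deleteVertex t (insertVertex t out into o) ≡ o
  deleteVertex-insertVertex =
    matrix-ext _ _ λ i j → trans (arc-deleteVertex t (insertVertex t out into o) i j) (arc-insert-punchIn i j)

insertVertex-deleteVertex : ∀ (t : Fin (suc n)) (out into : Fin n → Bool) (o : Matrix (suc n)) →
  arc o t t ≡ false → (∀ j → out j ≡ arc o t (punchIn t j)) → (∀ i → into i ≡ arc o (punchIn t i) t) →
  insertVertex t out into (deleteVertex t o) ≡ o
insertVertex-deleteVertex {n} t out into o t↛t out≡ into≡ = matrix-ext _ _ entry
  where
  o′ : Matrix n
  o′ = deleteVertex t o
  entry : ∀ i j → arc (insertVertex t out into o′) i j ≡ arc o i j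
  entry i j with punchInView t i | punchInView t j
  ... | at | at = trans (arc-insert-self t out into o′) (sym t↛t)
  ... | at | punched j′ = trans (arc-insert-out t out into o′ j′) (out≡ j′)
  ... | punched i′ | at = trans (arc-insert-into t out into o′ i′) (into≡ i′)
  ... | punched i′ | punched j′ = trans (arc-insert-punchIn t out into o′ i′ j′) (arc-deleteVertex t o i′ j′)

-- Deletion–contraction for non-adjacent twins

record NonAdjacentTwins {n : ℕ} (G : Graph n) (x y : Fin n) : Set where
  field
    twins-distinct : y ≢ x
    non-adjacent   : ¬ G x y
    x~⇒y~          : ∀ {z} → G x z → G y z
    y~⇒x~          : ∀ {z} → G y z → G x z

NonAdjacentTwins-swap : ∀ {n} {G : Graph n} {x y} → (∀ {i j} → G i j → G j i) →
                        NonAdjacentTwins G x y → NonAdjacentTwins G y x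
NonAdjacentTwins-swap G-sym twins = record
  { twins-distinct = twins-distinct ∘ sym
  ; non-adjacent   = non-adjacent ∘ G-sym
  ; x~⇒y~          = y~⇒x~
  ; y~⇒x~          = x~⇒y~
  }
  where open NonAdjacentTwins twins

module Twins {n : ℕ} {G : Graph (suc n)} (G-irrefl : ∀ i → ¬ G i i) (G-sym : ∀ {i j} → G i j → G j i)
             {x y : Fin (suc n)} (twins : NonAdjacentTwins G x y) where

  open NonAdjacentTwins twins renaming (twins-distinct to y≢x; non-adjacent to x≁y)

  XY : Graph (suc n)
  XY i j = (i ≡ x × j ≡ y) ⊎ (i ≡ y × j ≡ x)

  G+xy : Graph (suc n)
  G+xy i j = G i j ⊎ XY i j

  G-y : Graph n
  G-y i j = G (punchIn y i) (punchIn y j)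

  x≢y : x ≢ y
  x≢y = y≢x ∘ sym

  XY? : ∀ i j → Dec (XY i j)
  XY? i j = ((i ≟ x) ×-dec (j ≟ y)) ⊎-dec ((i ≟ y) ×-dec (j ≟ x))

  G⇒¬XY : ∀ {i j} → G i j → ¬ XY i j
  G⇒¬XY g (inj₁ (refl , refl)) = x≁y g
  G⇒¬XY g (inj₂ (refl , refl)) = x≁y (G-sym g)

  XY-sym : ∀ {i j} → XY i j → XY j i
  XY-sym (inj₁ (p , q)) = inj₂ (q , p)
  XY-sym (inj₂ (p , q)) = inj₁ (q , p)

  ¬XY-into : ∀ {a z} → z ≢ x → z ≢ y → ¬ XY a z
  ¬XY-into z≢x z≢y = [ z≢y ∘ proj₂ , z≢x ∘ proj₂ ]′

  ¬XY-out : ∀ {a z} → z ≢ x → z ≢ y → ¬ XY z a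
  ¬XY-out z≢x z≢y = [ z≢x ∘ proj₁ , z≢y ∘ proj₁ ]′

  G+xy⇒G : ∀ {i j} → G+xy i j → ¬ XY i j → G i j
  G+xy⇒G (inj₁ g) _ = g
  G+xy⇒G (inj₂ xy) ¬xy = ⊥-elim (¬xy xy)

  G+xy-sym : ∀ {i j} → G+xy i j → G+xy j i
  G+xy-sym (inj₁ g) = inj₁ (G-sym g)
  G+xy-sym (inj₂ xy) = inj₂ (XY-sym xy)

  G+xy-irrefl : ∀ i → ¬ G+xy i i
  G+xy-irrefl i (inj₁ g) = G-irrefl i g
  G+xy-irrefl i (inj₂ (inj₁ (refl , i≡y))) = x≢y i≡y
  G+xy-irrefl i (inj₂ (inj₂ (refl , i≡x))) = y≢x i≡x

  overwriteEntry : Bool → Bool → Matrix (suc n) → Fin (suc n) → Fin (suc n) → Bool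
  overwriteEntry bxy byx o i j with XY? i j
  ... | yes (inj₁ _) = bxy
  ... | yes (inj₂ _) = byx
  ... | no _ = arc o i j

  overwriteXY : Bool → Bool → Matrix (suc n) → Matrix (suc n)
  overwriteXY bxy byx o = matrix (overwriteEntry bxy byx o)

  module _ (bxy byx : Bool) (o : Matrix (suc n)) where

    arc-overwrite-xy : arc (overwriteXY bxy byx o) x y ≡ bxy
    arc-overwrite-xy rewrite arc-matrix (overwriteEntry bxy byx o) x y with XY? x y
    ... | yes (inj₁ _) = refl
    ... | yes (inj₂ (x≡y , _)) = ⊥-elim (x≢y x≡y)
    ... | no ¬xy = ⊥-elim (¬xy (inj₁ (refl , refl)))

    arc-overwrite-yx : arc (overwriteXY bxy byx o) y x ≡ byx
    arc-overwrite-yx rewrite arc-matrix (overwriteEntry bxy byx o) y x with XY? y x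
    ... | yes (inj₂ _) = refl
    ... | yes (inj₁ (y≡x , _)) = ⊥-elim (y≢x y≡x)
    ... | no ¬xy = ⊥-elim (¬xy (inj₂ (refl , refl)))

    arc-overwrite-other : ∀ {i j} → ¬ XY i j → arc (overwriteXY bxy byx o) i j ≡ arc o i j
    arc-overwrite-other {i} {j} ¬xy rewrite arc-matrix (overwriteEntry bxy byx o) i j with XY? i j
    ... | yes xy = ⊥-elim (¬xy xy)
    ... | no _ = refl

  x′ : Fin n
  x′ = punchOut y≢x

  punchIn-x′ : punchIn y x′ ≡ x
  punchIn-x′ = punchIn-punchOut y≢x

  x′~⇒y~ : ∀ {j} → G-y x′ j → G y (punchIn y j)
  x′~⇒y~ {j} g = x~⇒y~ (subst (λ v → G v (punchIn y j)) punchIn-x′ g)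

  y~⇒x′~ : ∀ {j} → G y (punchIn y j) → G-y x′ j
  y~⇒x′~ {j} g = subst (λ v → G v (punchIn y j)) (sym punchIn-x′) (y~⇒x~ g)

  punchIn-≢x : ∀ {j} → j ≢ x′ → punchIn y j ≢ x
  punchIn-≢x {j} j≢x′ e = j≢x′ (punchIn-injective y j x′ (trans e (sym punchIn-x′)))

  ¬XY-punchIn : ∀ i j → ¬ XY (punchIn y i) (punchIn y j)
  ¬XY-punchIn i j (inj₁ (_ , j≡y)) = punchInᵢ≢i y j j≡y
  ¬XY-punchIn i j (inj₂ (i≡y , _)) = punchInᵢ≢i y i i≡y

  deleteEdge : Matrix (suc n) → Matrix (suc n)
  deleteEdge = overwriteXY false false

  deleteEdge-⊆ : ∀ o i j → Arc (deleteEdge o) i j → Arc o i j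
  deleteEdge-⊆ o i j p with XY? i j
  ... | yes (inj₁ (refl , refl)) = ⊥-elim (subst T (arc-overwrite-xy false false o) p)
  ... | yes (inj₂ (refl , refl)) = ⊥-elim (subst T (arc-overwrite-yx false false o) p)
  ... | no ¬xy = subst T (arc-overwrite-other false false o ¬xy) p

  Detour : Matrix (suc n) → Set
  Detour o = ∃ λ z → Arc o y z × Arc o z x

  Detour? : ∀ o → Dec (Detour o)
  Detour? o = any? λ z → T? (arc o y z) ×-dec T? (arc o z x)

  -- Directing the new edge y → x exactly when there is a detour y → z → x creates no cycle.
  addEdge : Matrix (suc n) → Matrix (suc n)
  addEdge o = overwriteXY (not (does (Detour? o))) (does (Detour? o)) o

  addEdge-xy : ∀ o → arc (addEdge o) x y ≡ not (does (Detour? o))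
  addEdge-xy o = arc-overwrite-xy _ _ o

  addEdge-yx : ∀ o → arc (addEdge o) y x ≡ does (Detour? o)
  addEdge-yx o = arc-overwrite-yx _ _ o

  addEdge-other : ∀ o {i j} → ¬ XY i j → arc (addEdge o) i j ≡ arc o i j
  addEdge-other o = arc-overwrite-other _ _ o

  Clones : Matrix (suc n) → Set
  Clones o = ∀ z → z ≢ x → z ≢ y → arc o x z ≡ arc o y z × arc o z x ≡ arc o z y

  Clones? : ∀ o → Dec (Clones o)
  Clones? o = all? λ z → ¬? (z ≟ x) →-dec ¬? (z ≟ y) →-dec
                          ((arc o x z Bool.≟ arc o y z) ×-dec (arc o z x Bool.≟ arc o z y))

  -- The orientations of G + xy that come from G − y ≅ G/xy: y copies x and points to it.
  Contracted : Matrix (suc n) → Set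
  Contracted o = Clones o × Arc o y x

  Contracted? : ∀ o → Dec (Contracted o)
  Contracted? o = Clones? o ×-dec T? (arc o y x)

  -- y is re-inserted as a clone of x, with the arc y → x.
  insertClone : Matrix n → Matrix (suc n)
  insertClone o′ = insertVertex y (λ j → arc o′ x′ j ∨ does (j ≟ x′)) (λ i → arc o′ i x′) o′

  collapse : Fin (suc n) → Fin n
  collapse v = fromMaybe x′ (punchOut? y v)

  collapse-y : collapse y ≡ x′
  collapse-y = cong (fromMaybe x′) (punchOut?-self y)

  collapse-punchIn : ∀ i → collapse (punchIn y i) ≡ i
  collapse-punchIn i = cong (fromMaybe x′) (punchOut?-punchIn y i)

  collapse-x : collapse x ≡ x′
  collapse-x = trans (cong collapse (sym punchIn-x′)) (collapse-punchIn x′)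

  module _ {s : Fin (suc n)} (s≢y : s ≢ y) where

    s′ : Fin n
    s′ = punchOut (s≢y ∘ sym)

    punchIn-s′ : punchIn y s′ ≡ s
    punchIn-s′ = punchIn-punchOut _

    module FromG (o : Matrix (suc n)) (h : UniqueSinkAO G s o) where
      open AO h

      private
        E : Matrix (suc n)
        E = addEdge o

      arc⇒¬XY : ∀ {i j} → Arc o i j → ¬ XY i j
      arc⇒¬XY p = G⇒¬XY (arc⇒edge _ _ p)

      XY-false : ∀ {i j} → XY i j → arc o i j ≡ false
      XY-false xy = ¬T⇒≡false λ p → arc⇒¬XY p xy

      no-x⇝y : Detour o → ¬ Star (Arc o) x y
      no-x⇝y (z , y→z , z→x) x⇝y with first-step x≢y x⇝y
      ... | w , x→w , w⇝y with edge⇒arc y w (x~⇒y~ (arc⇒edge x w x→w))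
      ...   | inj₁ y→w = acyclic y→w w⇝y
      ...   | inj₂ w→y = acyclic x→w (w→y ◅ y→z ◅ z→x ◅ ε)

      no-y⇝x : ¬ Detour o → ¬ Star (Arc o) y x
      no-y⇝x ¬det y⇝x with first-step y≢x y⇝x
      ... | w , y→w , w⇝x with edge⇒arc x w (y~⇒x~ (arc⇒edge y w y→w))
      ...   | inj₁ x→w = acyclic x→w w⇝x
      ...   | inj₂ w→x = ¬det (w , y→w , w→x)

      E-other : ∀ {i j} → ¬ XY i j → arc E i j ≡ arc o i j
      E-other = addEdge-other o

      E-xy⇒¬detour : Arc E x y → ¬ Detour o
      E-xy⇒¬detour p det = subst T (trans (addEdge-xy o) (cong not (dec-true (Detour? o) det))) p

      E-yx⇒detour : Arc E y x → Detour o
      E-yx⇒detour p = T-does⇒ (Detour? o) (subst T (addEdge-yx o) p)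

      E-xy-or-yx : Arc E x y ⊎ Arc E y x
      E-xy-or-yx with Detour? o
      ... | yes det = inj₂ (subst T (sym (trans (addEdge-yx o) (dec-true (Detour? o) det))) _)
      ... | no ¬det = inj₁ (subst T (sym (trans (addEdge-xy o) (cong not (dec-false (Detour? o) ¬det)))) _)

      E-orients : Orients G+xy E
      E-orients = arc⇒edge′ , edge⇒arc′ , antisym′
        where
        arc⇒edge′ : ∀ i j → Arc E i j → G+xy i j
        arc⇒edge′ i j p with XY? i j
        ... | yes xy = inj₂ xy
        ... | no ¬xy = inj₁ (arc⇒edge i j (subst T (E-other ¬xy) p))

        edge⇒arc′ : ∀ i j → G+xy i j → Arc E i j ⊎ Arc E j i
        edge⇒arc′ i j (inj₁ g) with edge⇒arc i j g
        ... | inj₁ p = inj₁ (subst T (sym (E-other (G⇒¬XY g))) p)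
        ... | inj₂ p = inj₂ (subst T (sym (E-other (G⇒¬XY (G-sym g)))) p)
        edge⇒arc′ _ _ (inj₂ (inj₁ (refl , refl))) = E-xy-or-yx
        edge⇒arc′ _ _ (inj₂ (inj₂ (refl , refl))) = Sum.swap E-xy-or-yx

        antisym′ : ∀ i j → ¬ (Arc E i j × Arc E j i)
        antisym′ i j (p , q) with XY? i j
        ... | no ¬xy = antisym i j (subst T (E-other ¬xy) p) (subst T (E-other (¬xy ∘ XY-sym)) q)
        ... | yes (inj₁ (refl , refl)) = E-xy⇒¬detour p (E-yx⇒detour q)
        ... | yes (inj₂ (refl , refl)) = E-xy⇒¬detour q (E-yx⇒detour p)

      E-acyclic : Acyclic (Arc E)
      E-acyclic with Detour? o
      ... | yes det = Acyclic-addArc acyclic (no-x⇝y det) new-arc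
        where
        new-arc : ∀ {i j} → Arc E i j → Arc o i j ⊎ (i ≡ y × j ≡ x)
        new-arc {i} {j} p with XY? i j
        ... | no ¬xy = inj₁ (subst T (E-other ¬xy) p)
        ... | yes (inj₁ (refl , refl)) = ⊥-elim (E-xy⇒¬detour p det)
        ... | yes (inj₂ (refl , refl)) = inj₂ (refl , refl)
      ... | no ¬det = Acyclic-addArc acyclic (no-y⇝x ¬det) new-arc
        where
        new-arc : ∀ {i j} → Arc E i j → Arc o i j ⊎ (i ≡ x × j ≡ y)
        new-arc {i} {j} p with XY? i j
        ... | no ¬xy = inj₁ (subst T (E-other ¬xy) p)
        ... | yes (inj₁ (refl , refl)) = inj₂ (refl , refl)
        ... | yes (inj₂ (refl , refl)) = ⊥-elim (¬det (E-yx⇒detour p))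

      -- y is not a sink, and its out-neighbours are neighbours of the sink x.
      detour-if-sink-x : s ≡ x → Detour o
      detour-if-sink-x refl with any? (λ j → T? (arc o y j))
      ... | no y-sink = ⊥-elim (s≢y (sym (sink-unique y λ j p → y-sink (j , p))))
      ... | yes (j , y→j) with edge⇒arc s j (y~⇒x~ (arc⇒edge y j y→j))
      ...   | inj₁ s→j = ⊥-elim (sink j s→j)
      ...   | inj₂ j→s = j , y→j , j→s

      E-sink : IsSink E s
      E-sink j p with XY? s j
      ... | no ¬xy = sink j (subst T (E-other ¬xy) p)
      ... | yes (inj₂ (s≡y , _)) = s≢y s≡y
      ... | yes (inj₁ (s≡x , refl)) = E-xy⇒¬detour (subst (λ v → Arc E v y) s≡x p) (detour-if-sink-x s≡x)

      E-sink-unique : ∀ v → IsSink E v → v ≡ s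
      E-sink-unique v v-sink = sink-unique v λ j p → v-sink j (subst T (sym (E-other (arc⇒¬XY p))) p)

      addEdge-AO : UniqueSinkAO G+xy s E
      addEdge-AO = E-orients , Acyclic⇒IsAcyclic E-acyclic , E-sink , E-sink-unique

      addEdge-¬Contracted : ¬ Contracted E
      addEdge-¬Contracted (clones , y→x) with E-yx⇒detour y→x
      ... | z , y→z , z→x = antisym x z x→z z→x
        where
        z≢x : z ≢ x
        z≢x = arc⇒≢ G-irrefl z→x
        z≢y : z ≢ y
        z≢y = arc⇒≢ G-irrefl y→z ∘ sym
        x→z : Arc o x z
        x→z = subst T (trans (sym (E-other (¬XY-into z≢x z≢y)))
                             (trans (sym (proj₁ (clones z z≢x z≢y))) (E-other (¬XY-into z≢x z≢y)))) y→z

      deleteEdge-addEdge : deleteEdge E ≡ o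
      deleteEdge-addEdge = matrix-ext _ _ entry
        where
        entry : ∀ i j → arc (deleteEdge E) i j ≡ arc o i j
        entry i j with XY? i j
        ... | yes (inj₁ (refl , refl)) = trans (arc-overwrite-xy false false E) (sym (XY-false (inj₁ (refl , refl))))
        ... | yes (inj₂ (refl , refl)) = trans (arc-overwrite-yx false false E) (sym (XY-false (inj₂ (refl , refl))))
        ... | no ¬xy = trans (arc-overwrite-other false false E ¬xy) (E-other ¬xy)

    module ToG (o : Matrix (suc n)) (h : UniqueSinkAO G+xy s o) (¬contracted : ¬ Contracted o) where
      open AO h

      private
        D : Matrix (suc n)
        D = deleteEdge o

      D-other : ∀ {i j} → ¬ XY i j → arc D i j ≡ arc o i j
      D-other = arc-overwrite-other false false o

      ⇒D : ∀ {i j} → ¬ XY i j → Arc o i j → Arc D i j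
      ⇒D ¬xy = subst T (sym (D-other ¬xy))

      edge⇒arc-G : ∀ i j → G i j → Arc o i j ⊎ Arc o j i
      edge⇒arc-G i j g = edge⇒arc i j (inj₁ g)

      D-orients : Orients G D
      D-orients = arc⇒edge′ , edge⇒arc′ , antisym′
        where
        arc⇒edge′ : ∀ i j → Arc D i j → G i j
        arc⇒edge′ i j p with XY? i j
        ... | yes (inj₁ (refl , refl)) = ⊥-elim (subst T (arc-overwrite-xy false false o) p)
        ... | yes (inj₂ (refl , refl)) = ⊥-elim (subst T (arc-overwrite-yx false false o) p)
        ... | no ¬xy = G+xy⇒G (arc⇒edge i j (subst T (D-other ¬xy) p)) ¬xy

        edge⇒arc′ : ∀ i j → G i j → Arc D i j ⊎ Arc D j i
        edge⇒arc′ i j g with edge⇒arc-G i j g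
        ... | inj₁ p = inj₁ (⇒D (G⇒¬XY g) p)
        ... | inj₂ p = inj₂ (⇒D (G⇒¬XY (G-sym g)) p)

        antisym′ : ∀ i j → ¬ (Arc D i j × Arc D j i)
        antisym′ i j (p , q) = antisym i j (deleteEdge-⊆ o i j p) (deleteEdge-⊆ o j i q)

      clones-if-no-detour : ¬ Detour D → Arc o y x → Clones o
      clones-if-no-detour ¬det y→x z z≢x z≢y =
        T-ext x→z⇒y→z y→z⇒x→z , T-ext z→x⇒z→y z→y⇒z→x
        where
        ¬XY→z : ∀ {a} → ¬ XY a z
        ¬XY→z = ¬XY-into z≢x z≢y
        ¬XYz→ : ∀ {a} → ¬ XY z a
        ¬XYz→ = ¬XY-out z≢x z≢y

        detour : Arc o y z → Arc o z x → ⊥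
        detour y→z z→x = ¬det (z , ⇒D ¬XY→z y→z , ⇒D ¬XYz→ z→x)

        x→z⇒y→z : Arc o x z → Arc o y z
        x→z⇒y→z x→z with edge⇒arc-G y z (x~⇒y~ (G+xy⇒G (arc⇒edge x z x→z) ¬XY→z))
        ... | inj₁ y→z = y→z
        ... | inj₂ z→y = ⊥-elim (acyclic x→z (z→y ◅ y→x ◅ ε))

        y→z⇒x→z : Arc o y z → Arc o x z
        y→z⇒x→z y→z with edge⇒arc-G x z (y~⇒x~ (G+xy⇒G (arc⇒edge y z y→z) ¬XY→z))
        ... | inj₁ x→z = x→z
        ... | inj₂ z→x = ⊥-elim (detour y→z z→x)

        z→x⇒z→y : Arc o z x → Arc o z y
        z→x⇒z→y z→x with edge⇒arc-G y z (x~⇒y~ (G-sym (G+xy⇒G (arc⇒edge z x z→x) ¬XYz→)))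
        ... | inj₁ y→z = ⊥-elim (detour y→z z→x)
        ... | inj₂ z→y = z→y

        z→y⇒z→x : Arc o z y → Arc o z x
        z→y⇒z→x z→y with edge⇒arc-G x z (y~⇒x~ (G-sym (G+xy⇒G (arc⇒edge z y z→y) ¬XYz→)))
        ... | inj₁ x→z = ⊥-elim (acyclic x→z (z→y ◅ y→x ◅ ε))
        ... | inj₂ z→x = z→x

      y-sink-if-x-D-sink : Arc o x y → IsSink D x → IsSink o y
      y-sink-if-x-D-sink x→y x-sink j y→j = x↛j⇒⊥ (¬XY-into j≢x j≢y) (¬XY-into j≢x j≢y)
        where
        j≢x : j ≢ x
        j≢x refl = antisym x y x→y y→j
        j≢y : j ≢ y
        j≢y = arc⇒≢ G+xy-irrefl y→j ∘ sym
        x↛j⇒⊥ : ¬ XY y j → ¬ XY x j → ⊥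
        x↛j⇒⊥ ¬XYyj ¬XYxj with edge⇒arc-G x j (y~⇒x~ (G+xy⇒G (arc⇒edge y j y→j) ¬XYyj))
        ... | inj₁ x→j = x-sink j (⇒D ¬XYxj x→j)
        ... | inj₂ j→x = acyclic x→y (y→j ◅ j→x ◅ ε)

      D-sink-unique : ∀ v → IsSink D v → v ≡ s
      D-sink-unique v v-sink with any? (λ j → T? (arc o v j))
      ... | no v-sink-in-o = sink-unique v λ j p → v-sink-in-o (j , p)
      ... | yes (j , v→j) with XY? v j
      ...   | no ¬xy = ⊥-elim (v-sink j (⇒D ¬xy v→j))
      ...   | yes (inj₁ (refl , refl)) = ⊥-elim (s≢y (sym (sink-unique y (y-sink-if-x-D-sink v→j v-sink))))
      ...   | yes (inj₂ (refl , refl)) =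
              ⊥-elim (¬contracted (clones-if-no-detour (λ (z , y→z , _) → v-sink z y→z) v→j , v→j))

      deleteEdge-AO : UniqueSinkAO G s D
      deleteEdge-AO = D-orients ,
                      Acyclic⇒IsAcyclic (Acyclic-comap id (deleteEdge-⊆ o _ _) acyclic) ,
                      (λ j → sink j ∘ deleteEdge-⊆ o s j) ,
                      D-sink-unique

      detour≡yx : does (Detour? D) ≡ arc o y x
      detour≡yx = T-ext detour⇒y→x y→x⇒detour
        where
        detour⇒y→x : T (does (Detour? D)) → Arc o y x
        detour⇒y→x t with T-does⇒ (Detour? D) t | edge⇒arc x y (inj₂ (inj₁ (refl , refl)))
        ... | _ | inj₂ y→x = y→x
        ... | z , y→z , z→x | inj₁ x→y =
              ⊥-elim (acyclic x→y (deleteEdge-⊆ o y z y→z ◅ deleteEdge-⊆ o z x z→x ◅ ε))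
        y→x⇒detour : Arc o y x → T (does (Detour? D))
        y→x⇒detour y→x = subst T (sym (dec-true (Detour? D) detour)) _
          where
          detour : Detour D
          detour = decidable-stable (Detour? D) λ ¬det → ¬contracted (clones-if-no-detour ¬det y→x , y→x)

      addEdge-deleteEdge : addEdge D ≡ o
      addEdge-deleteEdge = matrix-ext _ _ entry
        where
        entry : ∀ i j → arc (addEdge D) i j ≡ arc o i j
        entry i j with XY? i j
        ... | no ¬xy = trans (addEdge-other D ¬xy) (D-other ¬xy)
        ... | yes (inj₂ (refl , refl)) = trans (addEdge-yx D) detour≡yx
        ... | yes (inj₁ (refl , refl)) =
              trans (addEdge-xy D) (trans (cong not detour≡yx)
                (sym (T⊎T⇒≡not (edge⇒arc x y (inj₂ (inj₁ (refl , refl)))) λ (p , q) → antisym x y p q)))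

    module FromG-y (o′ : Matrix n) (h : UniqueSinkAO G-y s′ o′) where
      open AO h

      private
        out : Fin n → Bool
        out j = arc o′ x′ j ∨ does (j ≟ x′)

        E : Matrix (suc n)
        E = insertClone o′

      E-self : arc E y y ≡ false
      E-self = arc-insert-self y out _ o′

      E-out : ∀ j → arc E y (punchIn y j) ≡ out j
      E-out = arc-insert-out y out _ o′

      E-into : ∀ i → arc E (punchIn y i) y ≡ arc o′ i x′
      E-into = arc-insert-into y out _ o′

      E-punchIn : ∀ i j → arc E (punchIn y i) (punchIn y j) ≡ arc o′ i j
      E-punchIn = arc-insert-punchIn y out _ o′

      out-cases : ∀ {j} → T (out j) → Arc o′ x′ j ⊎ j ≡ x′
      out-cases {j} t with Equivalence.to Bool.T-∨ t
      ... | inj₁ x′→j = inj₁ x′→j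
      ... | inj₂ j≟x′ = inj₂ (T-does⇒ (j ≟ x′) j≟x′)

      out-x′ : T (out x′)
      out-x′ = Equivalence.from (Bool.T-∨ {arc o′ x′ x′}) (inj₂ (subst T (sym (dec-true (x′ ≟ x′) refl)) _))

      y→x : Arc E y x
      y→x = subst (λ v → Arc E y v) punchIn-x′ (subst T (sym (E-out x′)) out-x′)

      y-edge⇒arc : ∀ j → G+xy y (punchIn y j) → Arc E y (punchIn y j) ⊎ Arc E (punchIn y j) y
      y-edge⇒arc j (inj₂ (inj₁ (y≡x , _))) = ⊥-elim (y≢x y≡x)
      y-edge⇒arc j (inj₂ (inj₂ (_ , pj≡x))) =
        inj₁ (subst (λ v → Arc E y v) (sym pj≡x) y→x)
      y-edge⇒arc j (inj₁ g) with edge⇒arc x′ j (y~⇒x′~ g)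
      ... | inj₁ x′→j = inj₁ (subst T (sym (E-out j)) (Equivalence.from Bool.T-∨ (inj₁ x′→j)))
      ... | inj₂ j→x′ = inj₂ (subst T (sym (E-into j)) j→x′)

      y-antisym : ∀ j → Arc E y (punchIn y j) → ¬ Arc E (punchIn y j) y
      y-antisym j p q with out-cases (subst T (E-out j) p)
      ... | inj₁ x′→j = antisym x′ j x′→j (subst T (E-into j) q)
      ... | inj₂ refl = G-irrefl x (subst (λ v → G v v) punchIn-x′ (arc⇒edge x′ x′ (subst T (E-into x′) q)))

      E-orients : Orients G+xy E
      E-orients = arc⇒edge′ , edge⇒arc′ , antisym′
        where
        arc⇒edge′ : ∀ i j → Arc E i j → G+xy i j
        arc⇒edge′ i j p with punchInView y i | punchInView y j
        ... | at | at = ⊥-elim (subst T E-self p)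
        ... | at | punched j′ with out-cases (subst T (E-out j′) p)
        ...   | inj₁ x′→j′ = inj₁ (x′~⇒y~ (arc⇒edge x′ j′ x′→j′))
        ...   | inj₂ refl = inj₂ (inj₂ (refl , punchIn-x′))
        arc⇒edge′ i j p | punched i′ | at =
          inj₁ (G-sym (x′~⇒y~ (G-sym (arc⇒edge i′ x′ (subst T (E-into i′) p)))))
        arc⇒edge′ i j p | punched i′ | punched j′ = inj₁ (arc⇒edge i′ j′ (subst T (E-punchIn i′ j′) p))

        edge⇒arc′ : ∀ i j → G+xy i j → Arc E i j ⊎ Arc E j i
        edge⇒arc′ i j g with punchInView y i | punchInView y j
        ... | at | at = ⊥-elim (G+xy-irrefl y g)
        ... | at | punched j′ = y-edge⇒arc j′ g
        ... | punched i′ | at = Sum.swap (y-edge⇒arc i′ (G+xy-sym g))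
        ... | punched i′ | punched j′ with edge⇒arc i′ j′ (G+xy⇒G g (¬XY-punchIn i′ j′))
        ...   | inj₁ p = inj₁ (subst T (sym (E-punchIn i′ j′)) p)
        ...   | inj₂ p = inj₂ (subst T (sym (E-punchIn j′ i′)) p)

        antisym′ : ∀ i j → ¬ (Arc E i j × Arc E j i)
        antisym′ i j (p , q) with punchInView y i | punchInView y j
        ... | at | at = subst T E-self p
        ... | at | punched j′ = y-antisym j′ p q
        ... | punched i′ | at = y-antisym i′ q p
        ... | punched i′ | punched j′ = antisym i′ j′ (subst T (E-punchIn i′ j′) p) (subst T (E-punchIn j′ i′) q)

      collapse-hom : ∀ {i j} → Arc E i j × ¬ (i ≡ y × j ≡ x) → Arc o′ (collapse i) (collapse j)
      collapse-hom {i} {j} (p , not-yx) with punchInView y i | punchInView y j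
      ... | at | at = ⊥-elim (subst T E-self p)
      ... | at | punched j′ with out-cases (subst T (E-out j′) p)
      ...   | inj₁ x′→j′ = subst T (sym (cong₂ (arc o′) collapse-y (collapse-punchIn j′))) x′→j′
      ...   | inj₂ refl = ⊥-elim (not-yx (refl , punchIn-x′))
      collapse-hom (p , _) | punched i′ | at =
        subst T (sym (cong₂ (arc o′) (collapse-punchIn i′) collapse-y)) (subst T (E-into i′) p)
      collapse-hom (p , _) | punched i′ | punched j′ =
        subst T (sym (cong₂ (arc o′) (collapse-punchIn i′) (collapse-punchIn j′))) (subst T (E-punchIn i′ j′) p)

      E-acyclic : Acyclic (Arc E)
      E-acyclic = Acyclic-addArc (Acyclic-comap collapse collapse-hom acyclic) no-x⇝y new-arc
        where
        no-x⇝y : ¬ Star (λ i j → Arc E i j × ¬ (i ≡ y × j ≡ x)) x y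
        no-x⇝y x⇝y with first-step x≢y x⇝y
        ... | w , x→w , w⇝y =
              acyclic (subst (λ v → Arc o′ v (collapse w)) collapse-x (collapse-hom x→w))
                      (subst (Star (Arc o′) (collapse w)) collapse-y (gmap collapse collapse-hom w⇝y))
        new-arc : ∀ {i j} → Arc E i j → (Arc E i j × ¬ (i ≡ y × j ≡ x)) ⊎ (i ≡ y × j ≡ x)
        new-arc {i} {j} p with i ≟ y | j ≟ x
        ... | yes i≡y | yes j≡x = inj₂ (i≡y , j≡x)
        ... | no i≢y | _ = inj₁ (p , i≢y ∘ proj₁)
        ... | yes _ | no j≢x = inj₁ (p , j≢x ∘ proj₂)

      E-sink : IsSink E s
      E-sink = subst (IsSink E) punchIn-s′ s-sink
        where
        s-sink : IsSink E (punchIn y s′)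
        s-sink j p with punchInView y j
        ... | at = sink x′ (subst T (E-into s′) p)
        ... | punched j′ = sink j′ (subst T (E-punchIn s′ j′) p)

      E-sink-unique : ∀ v → IsSink E v → v ≡ s
      E-sink-unique v v-sink with punchInView y v
      ... | at = ⊥-elim (v-sink x y→x)
      ... | punched v′ =
            trans (cong (punchIn y) (sink-unique v′ λ j p → v-sink (punchIn y j) (subst T (sym (E-punchIn v′ j)) p)))
                               punchIn-s′

      insertClone-AO : UniqueSinkAO G+xy s E
      insertClone-AO = E-orients , Acyclic⇒IsAcyclic E-acyclic , E-sink , E-sink-unique

      insertClone-Contracted : Contracted E
      insertClone-Contracted = clones , y→x
        where
        clones : Clones E
        clones z z≢x z≢y with punchInView y z
        ... | at = ⊥-elim (z≢y refl)
        ... | punched z′ = out-equal , into-equal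
          where
          z′≢x′ : z′ ≢ x′
          z′≢x′ refl = z≢x punchIn-x′
          out-equal : arc E x (punchIn y z′) ≡ arc E y (punchIn y z′)
          out-equal = begin
            arc E x (punchIn y z′)            ≡⟨ cong (λ v → arc E v (punchIn y z′)) (sym punchIn-x′) ⟩
            arc E (punchIn y x′) (punchIn y z′) ≡⟨ E-punchIn x′ z′ ⟩
            arc o′ x′ z′                       ≡⟨ sym (Bool.∨-identityʳ _) ⟩
            arc o′ x′ z′ ∨ false               ≡⟨ cong (arc o′ x′ z′ ∨_) (sym (dec-false (z′ ≟ x′) z′≢x′)) ⟩
            out z′                            ≡⟨ sym (E-out z′) ⟩
            arc E y (punchIn y z′)            ∎
          into-equal : arc E (punchIn y z′) x ≡ arc E (punchIn y z′) y
          into-equal = begin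
            arc E (punchIn y z′) x              ≡⟨ cong (arc E (punchIn y z′)) (sym punchIn-x′) ⟩
            arc E (punchIn y z′) (punchIn y x′) ≡⟨ E-punchIn z′ x′ ⟩
            arc o′ z′ x′                        ≡⟨ sym (E-into z′) ⟩
            arc E (punchIn y z′) y              ∎

      deleteVertex-insertClone : deleteVertex y E ≡ o′
      deleteVertex-insertClone = deleteVertex-insertVertex y out _ o′

    module ToG-y (o : Matrix (suc n)) (h : UniqueSinkAO G+xy s o) (contracted : Contracted o) where
      open AO h

      private
        D : Matrix n
        D = deleteVertex y o

        clones : Clones o
        clones = proj₁ contracted

        y→x : Arc o y x
        y→x = proj₂ contracted

      D-arc : ∀ i j → arc D i j ≡ arc o (punchIn y i) (punchIn y j)
      D-arc = arc-deleteVertex y o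

      D-orients : Orients G-y D
      D-orients =
        (λ i j p → G+xy⇒G (arc⇒edge _ _ (subst T (D-arc i j) p)) (¬XY-punchIn i j)) ,
        (λ i j g → Sum.map (subst T (sym (D-arc i j))) (subst T (sym (D-arc j i))) (edge⇒arc _ _ (inj₁ g))) ,
        (λ i j (p , q) → antisym _ _ (subst T (D-arc i j) p) (subst T (D-arc j i) q))

      x↛y : ¬ Arc o x y
      x↛y x→y = antisym x y x→y y→x

      -- A vertex other than x, y points to y iff it points to x, which survives in D.
      D-sink-unique : ∀ v′ → IsSink D v′ → v′ ≡ s′
      D-sink-unique v′ v′-sink = punchIn-injective y v′ s′ (trans (sink-unique _ v-sink) (sym punchIn-s′))
        where
        v-sink : IsSink o (punchIn y v′)
        v-sink j p with punchInView y j
        ... | punched j′ = v′-sink j′ (subst T (sym (D-arc v′ j′)) p)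
        ... | at with punchIn y v′ ≟ x
        ...   | yes v≡x = x↛y (subst (λ v → Arc o v y) v≡x p)
        ...   | no v≢x = v′-sink x′ (subst T (sym (D-arc v′ x′))
                            (subst (λ v → Arc o (punchIn y v′) v) (sym punchIn-x′)
                              (subst T (sym (proj₂ (clones _ v≢x (punchInᵢ≢i y v′)))) p)))

      deleteVertex-AO : UniqueSinkAO G-y s′ D
      deleteVertex-AO =
        D-orients ,
        Acyclic⇒IsAcyclic (Acyclic-comap (punchIn y) (λ {i} {j} → subst T (D-arc i j)) acyclic) ,
        (λ j p → sink (punchIn y j) (subst (λ v → Arc o v (punchIn y j)) punchIn-s′ (subst T (D-arc s′ j) p))) ,
        D-sink-unique

      insertClone-deleteVertex : insertClone D ≡ o
      insertClone-deleteVertex =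
        insertVertex-deleteVertex y _ _ o (¬T⇒≡false λ p → arc⇒≢ G+xy-irrefl p refl) out-equal into-equal
        where
        out-equal : ∀ j → arc D x′ j ∨ does (j ≟ x′) ≡ arc o y (punchIn y j)
        out-equal j with j ≟ x′
        ... | yes refl = trans (Bool.∨-zeroʳ _) (sym (subst (λ v → arc o y v ≡ true) (sym punchIn-x′)
                                                     (Equivalence.to Bool.T-≡ y→x)))
        ... | no j≢x′ = begin
          arc D x′ j ∨ false                 ≡⟨ Bool.∨-identityʳ _ ⟩
          arc D x′ j                         ≡⟨ D-arc x′ j ⟩
          arc o (punchIn y x′) (punchIn y j) ≡⟨ cong (λ v → arc o v (punchIn y j)) punchIn-x′ ⟩
          arc o x (punchIn y j)              ≡⟨ proj₁ (clones _ (punchIn-≢x j≢x′) (punchInᵢ≢i y j)) ⟩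
          arc o y (punchIn y j)              ∎
        into-equal : ∀ i → arc D i x′ ≡ arc o (punchIn y i) y
        into-equal i with punchIn y i ≟ x
        ... | yes i≡x = begin
          arc D i x′                         ≡⟨ D-arc i x′ ⟩
          arc o (punchIn y i) (punchIn y x′) ≡⟨ cong₂ (arc o) i≡x punchIn-x′ ⟩
          arc o x x                          ≡⟨ ¬T⇒≡false (λ p → arc⇒≢ G+xy-irrefl p refl) ⟩
          false                              ≡⟨ sym (¬T⇒≡false x↛y) ⟩
          arc o x y                          ≡⟨ cong (λ v → arc o v y) (sym i≡x) ⟩
          arc o (punchIn y i) y              ∎
        ... | no i≢x = begin
          arc D i x′                         ≡⟨ D-arc i x′ ⟩
          arc o (punchIn y i) (punchIn y x′) ≡⟨ cong (arc o (punchIn y i)) punchIn-x′ ⟩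
          arc o (punchIn y i) x              ≡⟨ proj₂ (clones _ i≢x (punchInᵢ≢i y i)) ⟩
          arc o (punchIn y i) y              ∎

    deletion-contraction : ∀ {m m′} →
      HasCount (UniqueSinkAO G+xy s) m → HasCount (UniqueSinkAO G-y s′) m′ →
      Σ ℕ λ k → HasCount (UniqueSinkAO G s) k × k + m′ ≡ m
    deletion-contraction {m} {m′} count+xy count-y with HasCount-split Contracted? count+xy
    ... | l , k , count-contracted , count-other , l+k≡m = k , count , (begin
      k + m′ ≡⟨ cong (λ v → k + v) (HasCount-unique count-y′ count-contracted) ⟩
      k + l  ≡⟨ +-comm k l ⟩
      l + k  ≡⟨ l+k≡m ⟩
      m      ∎)
      where
      count : HasCount (UniqueSinkAO G s) k
      count = HasCount-bijection deleteEdge addEdge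
        (λ (h , ¬c) → ToG.deleteEdge-AO _ h ¬c)
        (λ h → FromG.addEdge-AO _ h , FromG.addEdge-¬Contracted _ h)
        (FromG.deleteEdge-addEdge _)
        (λ (h , ¬c) → ToG.addEdge-deleteEdge _ h ¬c)
        count-other
      count-y′ : HasCount (UniqueSinkAO G+xy s ∩ Contracted) m′
      count-y′ = HasCount-bijection insertClone (deleteVertex y)
        (λ h → FromG-y.insertClone-AO _ h , FromG-y.insertClone-Contracted _ h)
        (λ (h , c) → ToG-y.deleteVertex-AO _ h c)
        (λ (h , c) → ToG-y.insertClone-deleteVertex _ h c)
        (FromG-y.deleteVertex-insertClone _)
        count-y

-- Complete graphs

Complete : (n : ℕ) → Graph n
Complete n i j = i ≢ j

IsSource : ∀ {n} → Graph n → Fin n → Set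
IsSource R t = ∀ j → t ≢ j → R t j

tournament-source : ∀ m (R : Graph (suc m)) → (∀ i j → i ≢ j → R i j ⊎ R j i) → Acyclic R → ∃ (IsSource R)
tournament-source zero R _ _ = zero , λ { zero 0≢0 → ⊥-elim (0≢0 refl) }
tournament-source (suc m) R total acyclic
  with tournament-source m (λ i j → R (suc i) (suc j)) (λ i j i≢j → total (suc i) (suc j) (i≢j ∘ Fin.suc-injective))
                         (Acyclic-comap suc id acyclic)
... | t , t-source with total zero (suc t) (λ ())
...   | inj₂ t→0 = suc t , source
  where
  source : IsSource R (suc t)
  source zero _ = t→0
  source (suc j) t≢j = t-source j (t≢j ∘ cong suc)
...   | inj₁ 0→t = zero , source
  where
  source : IsSource R zero
  source zero 0≢0 = ⊥-elim (0≢0 refl)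
  source (suc j) _ with j ≟ t
  ... | yes refl = 0→t
  ... | no j≢t with total zero (suc j) (λ ())
  ...   | inj₁ 0→j = 0→j
  ...   | inj₂ j→0 = ⊥-elim (acyclic 0→t (t-source j (j≢t ∘ sym) ◅ j→0 ◅ ε))

module CompleteStep {n : ℕ} (s : Fin (suc (suc n))) (t′ : Fin (suc n)) where

  t : Fin (suc (suc n))
  t = punchIn s t′

  s″ : Fin (suc n)
  s″ = punchOut (punchInᵢ≢i s t′)

  punchIn-s″ : punchIn t s″ ≡ s
  punchIn-s″ = punchIn-punchOut _

  WithSource : Matrix (suc (suc n)) → Set
  WithSource o = UniqueSinkAO (Complete _) s o × IsSource (Arc o) t

  addSource : Matrix (suc n) → Matrix (suc (suc n))
  addSource = insertVertex t (const true) (const false)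

  module FromSmaller (o′ : Matrix (suc n)) (h : UniqueSinkAO (Complete _) s″ o′) where
    open AO h

    private
      E : Matrix (suc (suc n))
      E = addSource o′

    E-self : arc E t t ≡ false
    E-self = arc-insert-self t (const true) (const false) o′

    E-out : ∀ j → arc E t (punchIn t j) ≡ true
    E-out = arc-insert-out t (const true) (const false) o′

    E-into : ∀ i → arc E (punchIn t i) t ≡ false
    E-into = arc-insert-into t (const true) (const false) o′

    E-punchIn : ∀ i j → arc E (punchIn t i) (punchIn t j) ≡ arc o′ i j
    E-punchIn = arc-insert-punchIn t (const true) (const false) o′

    E-source : IsSource (Arc E) t
    E-source j t≢j with punchInView t j
    ... | at = ⊥-elim (t≢j refl)
    ... | punched j′ = subst T (sym (E-out j′)) _

    nothing-into-t : ∀ i → ¬ Arc E i t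
    nothing-into-t i p with punchInView t i
    ... | at = subst T E-self p
    ... | punched i′ = subst T (E-into i′) p

    E-orients : Orients (Complete _) E
    E-orients = arc⇒edge′ , edge⇒arc′ , antisym′
      where
      arc⇒edge′ : ∀ i j → Arc E i j → i ≢ j
      arc⇒edge′ i j p with punchInView t i | punchInView t j
      ... | at | _ = λ i≡j → nothing-into-t i (subst (Arc E i) (sym i≡j) p)
      ... | punched i′ | at = punchInᵢ≢i t i′
      ... | punched i′ | punched j′ = arc⇒edge i′ j′ (subst T (E-punchIn i′ j′) p) ∘ punchIn-injective t i′ j′

      edge⇒arc′ : ∀ i j → i ≢ j → Arc E i j ⊎ Arc E j i
      edge⇒arc′ i j i≢j with punchInView t i | punchInView t j
      ... | at | _ = inj₁ (E-source j i≢j)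
      ... | punched _ | at = inj₂ (E-source i (i≢j ∘ sym))
      ... | punched i′ | punched j′ =
            Sum.map (subst T (sym (E-punchIn i′ j′))) (subst T (sym (E-punchIn j′ i′)))
                         (edge⇒arc i′ j′ (i≢j ∘ cong (punchIn t)))

      antisym′ : ∀ i j → ¬ (Arc E i j × Arc E j i)
      antisym′ i j (p , q) with punchInView t i | punchInView t j
      ... | at | _ = nothing-into-t j q
      ... | punched _ | at = nothing-into-t i p
      ... | punched i′ | punched j′ = antisym i′ j′ (subst T (E-punchIn i′ j′) p) (subst T (E-punchIn j′ i′) q)

    E-acyclic : Acyclic (Arc E)
    E-acyclic = Acyclic-addSource restrict t (λ {i} → nothing-into-t i) hom acyclic
      where
      restrict : Fin (suc (suc n)) → Fin (suc n)
      restrict v = fromMaybe s″ (punchOut? t v)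
      restrict-punchIn : ∀ i → restrict (punchIn t i) ≡ i
      restrict-punchIn i = cong (fromMaybe s″) (punchOut?-punchIn t i)
      hom : ∀ {i j} → Arc E i j → i ≢ t → Arc o′ (restrict i) (restrict j)
      hom {i} {j} p i≢t with punchInView t i | punchInView t j
      ... | at | _ = ⊥-elim (i≢t refl)
      ... | punched _ | at = ⊥-elim (nothing-into-t i p)
      ... | punched i′ | punched j′ =
            subst T (sym (cong₂ (arc o′) (restrict-punchIn i′) (restrict-punchIn j′))) (subst T (E-punchIn i′ j′) p)

    E-sink : IsSink E s
    E-sink = subst (IsSink E) punchIn-s″ s-sink
      where
      s-sink : IsSink E (punchIn t s″)
      s-sink j p with punchInView t j
      ... | at = nothing-into-t (punchIn t s″) p
      ... | punched j′ = sink j′ (subst T (E-punchIn s″ j′) p)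

    E-sink-unique : ∀ v → IsSink E v → v ≡ s
    E-sink-unique v v-sink with punchInView t v
    ... | at = ⊥-elim (v-sink (punchIn t zero) (E-source _ (punchInᵢ≢i t zero ∘ sym)))
    ... | punched v′ =
          trans (cong (punchIn t) (sink-unique v′ λ j p → v-sink (punchIn t j) (subst T (sym (E-punchIn v′ j)) p)))
                             punchIn-s″

    addSource-WithSource : WithSource E
    addSource-WithSource = (E-orients , Acyclic⇒IsAcyclic E-acyclic , E-sink , E-sink-unique) , E-source

  module ToSmaller (o : Matrix (suc (suc n))) (h : WithSource o) where
    open AO (proj₁ h)

    private
      D : Matrix (suc n)
      D = deleteVertex t o

      D-arc : ∀ i j → arc D i j ≡ arc o (punchIn t i) (punchIn t j)
      D-arc = arc-deleteVertex t o

    nothing-into-t : ∀ i → ¬ Arc o i t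
    nothing-into-t i p with i ≟ t
    ... | yes refl = arc⇒edge t t p refl
    ... | no i≢t = antisym t i (proj₂ h i (i≢t ∘ sym)) p

    D-orients : Orients (Complete _) D
    D-orients =
      (λ i j p → arc⇒edge _ _ (subst T (D-arc i j) p) ∘ cong (punchIn t)) ,
      (λ i j i≢j → Sum.map (subst T (sym (D-arc i j))) (subst T (sym (D-arc j i)))
                                (edge⇒arc _ _ (i≢j ∘ punchIn-injective t i j))) ,
      (λ i j (p , q) → antisym _ _ (subst T (D-arc i j) p) (subst T (D-arc j i) q))

    D-sink-unique : ∀ v′ → IsSink D v′ → v′ ≡ s″
    D-sink-unique v′ v′-sink = punchIn-injective t v′ s″ (trans (sink-unique _ v-sink) (sym punchIn-s″))
      where
      v-sink : IsSink o (punchIn t v′)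
      v-sink j p with punchInView t j
      ... | at = nothing-into-t (punchIn t v′) p
      ... | punched j′ = v′-sink j′ (subst T (sym (D-arc v′ j′)) p)

    deleteVertex-AO : UniqueSinkAO (Complete _) s″ D
    deleteVertex-AO =
      D-orients ,
      Acyclic⇒IsAcyclic (Acyclic-comap (punchIn t) (λ {i} {j} → subst T (D-arc i j)) acyclic) ,
      (λ j p → sink (punchIn t j) (subst (λ v → Arc o v (punchIn t j)) punchIn-s″ (subst T (D-arc s″ j) p))) ,
      D-sink-unique

    addSource-deleteVertex : addSource D ≡ o
    addSource-deleteVertex =
      insertVertex-deleteVertex t _ _ o (¬T⇒≡false (nothing-into-t t))
        (λ j → sym (Equivalence.to Bool.T-≡ (proj₂ h (punchIn t j) (punchInᵢ≢i t j ∘ sym))))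
        (λ i → sym (¬T⇒≡false (nothing-into-t (punchIn t i))))

  count-WithSource : HasCount (UniqueSinkAO (Complete _) s″) (n !) → HasCount WithSource (n !)
  count-WithSource = HasCount-bijection addSource (deleteVertex t)
    (FromSmaller.addSource-WithSource _) (ToSmaller.deleteVertex-AO _) (ToSmaller.addSource-deleteVertex _)
    (λ {o′} _ → deleteVertex-insertVertex t (const true) (const false) o′)

count-single-vertex : (s : Fin 1) → HasCount (UniqueSinkAO (Complete 1) s) 1
count-single-vertex zero = empty ∷ [] , [] ∷ [] , (λ o → mk⇔ (λ { (here refl) → empty-AO }) (here ∘ only)) , refl
  where
  empty : Matrix 1
  empty = (false ∷ []) ∷ []

  no-arc : ∀ i j → ¬ Arc empty i j
  no-arc zero zero ()

  empty-AO : UniqueSinkAO (Complete 1) zero empty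
  empty-AO = ((λ i j → ⊥-elim ∘ no-arc i j) ,
              (λ { zero zero 0≢0 → ⊥-elim (0≢0 refl) }) ,
              (λ i j → no-arc i j ∘ proj₁)) ,
             Acyclic⇒IsAcyclic (λ {i} {j} p _ → no-arc i j p) , no-arc zero , (λ { zero _ → refl })

  only : ∀ {o} → UniqueSinkAO (Complete 1) zero o → o ≡ empty
  only h = matrix-ext _ _ λ { zero zero → ¬T⇒≡false λ p → AO.arc⇒edge h zero zero p refl }

count-complete : ∀ n (s : Fin (suc n)) → HasCount (UniqueSinkAO (Complete (suc n)) s) (n !)
count-complete zero s = count-single-vertex s
count-complete (suc n) s =
  HasCount-cong source-decomposition
    (HasCount-Σ-Fin WithSource (λ t′ → count-WithSource t′ (count-complete n (s″ t′))) source-unique)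
  where
  open CompleteStep s

  source-unique : ∀ {t₁ t₂ o} → WithSource t₁ o → WithSource t₂ o → t₁ ≡ t₂
  source-unique {t₁} {t₂} (h , t₁-source) (_ , t₂-source) with punchIn s t₁ ≟ punchIn s t₂
  ... | yes eq = punchIn-injective s t₁ t₂ eq
  ... | no t₁≢t₂ = ⊥-elim (AO.antisym h _ _ (t₁-source _ t₁≢t₂) (t₂-source _ (t₁≢t₂ ∘ sym)))

  source-decomposition : ∀ o → (∃ λ t′ → WithSource t′ o) ⇔ UniqueSinkAO (Complete _) s o
  source-decomposition o = mk⇔ (proj₁ ∘ proj₂) with-source
    where
    with-source : UniqueSinkAO (Complete _) s o → ∃ λ t′ → WithSource t′ o
    with-source h with tournament-source (suc n) (Arc o) (AO.edge⇒arc h) (AO.acyclic h)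
    ... | u , u-source with s ≟ u
    ...   | yes refl = ⊥-elim (AO.sink h _ (u-source (punchIn u zero) (punchInᵢ≢i u zero ∘ sym)))
    ...   | no s≢u = punchOut s≢u , h , subst (IsSource (Arc o)) (sym (punchIn-punchOut s≢u)) u-source

-- Complete graphs minus disjoint edges

HalfPair : (r k a b : ℕ) → Set
HalfPair r k a b = b ≡ r + a × a < k

Paired : (r k a b : ℕ) → Set
Paired r k a b = HalfPair r k a b ⊎ HalfPair r k b a

Paired? : ∀ r k a b → Dec (Paired r k a b)
Paired? r k a b = ((b ℕ.≟ r + a) ×-dec (a <? k)) ⊎-dec ((a ℕ.≟ r + b) ×-dec (b <? k))

MinusPairs : (n r k : ℕ) → Graph n
MinusPairs n r k i j = toℕ i ≢ toℕ j × ¬ Paired r k (toℕ i) (toℕ j)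

MinusPairs-sym : ∀ {n r k i j} → MinusPairs n r k i j → MinusPairs n r k j i
MinusPairs-sym (i≢j , ¬paired) = i≢j ∘ sym , ¬paired ∘ Sum.swap

MinusPairs-irrefl : ∀ {n r k} i → ¬ MinusPairs n r k i i
MinusPairs-irrefl i (i≢i , _) = i≢i refl

MinusPairs₀⇔Complete : ∀ {n r} i j → MinusPairs n r 0 i j ⇔ Complete n i j
MinusPairs₀⇔Complete i j = mk⇔ (λ (i≢j , _) → i≢j ∘ cong toℕ)
                                (λ i≢j → i≢j ∘ toℕ-injective , λ { (inj₁ (_ , ())) ; (inj₂ (_ , ())) })

Paired-suc : ∀ {r k a b} → Paired r k a b → Paired r (suc k) a b
Paired-suc = Sum.map (Product.map₂ m<n⇒m<1+n) (Product.map₂ m<n⇒m<1+n)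

Paired-suc⁻ : ∀ {r k a b} → Paired r (suc k) a b →
              Paired r k a b ⊎ ((a ≡ k × b ≡ r + k) ⊎ (a ≡ r + k × b ≡ k))
Paired-suc⁻ (inj₁ (b≡r+a , a<1+k)) with m<1+n⇒m<n∨m≡n a<1+k
... | inj₁ a<k = inj₁ (inj₁ (b≡r+a , a<k))
... | inj₂ refl = inj₂ (inj₁ (refl , b≡r+a))
Paired-suc⁻ (inj₂ (a≡r+b , b<1+k)) with m<1+n⇒m<n∨m≡n b<1+k
... | inj₁ b<k = inj₁ (inj₂ (a≡r+b , b<k))
... | inj₂ refl = inj₂ (inj₂ (a≡r+b , refl))

module _ {r k : ℕ} (0<r : 0 < r) where

  k<r+k : k < r + k
  k<r+k = m<n+m k 0<r

  ¬Paired-new : ¬ Paired r k k (r + k)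
  ¬Paired-new (inj₁ (_ , k<k)) = <-irrefl refl k<k
  ¬Paired-new (inj₂ (k≡r+r+k , _)) = <-irrefl k≡r+r+k (<-≤-trans k<r+k (m≤n+m (r + k) r))

  Paired-new-y : ∀ {c} → Paired r (suc k) (r + k) c → c ≡ k
  Paired-new-y (inj₁ (_ , r+k<1+k)) = ⊥-elim (<-irrefl refl (<-≤-trans k<r+k (s≤s⁻¹ r+k<1+k)))
  Paired-new-y {c} (inj₂ (r+k≡r+c , _)) = sym (+-cancelˡ-≡ r k c r+k≡r+c)

Paired-new-x : ∀ {r k c} → k < r → Paired r (suc k) k c → c ≡ r + k
Paired-new-x _ (inj₁ (c≡r+k , _)) = c≡r+k
Paired-new-x {r} {k} {c} k<r (inj₂ (k≡r+c , _)) = ⊥-elim (<-irrefl k≡r+c (<-≤-trans k<r (m≤m+n r c)))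

-- a′ is the position of a after a new element has been inserted at position Y.
ShiftedPast : ℕ → ℕ → ℕ → Set
ShiftedPast Y a a′ = (a < Y × a′ ≡ a) ⊎ (Y ≤ a × a′ ≡ suc a)

ShiftedPast-punchIn : ∀ {m} (y : Fin (suc m)) (i : Fin m) → ShiftedPast (toℕ y) (toℕ i) (toℕ (punchIn y i))
ShiftedPast-punchIn y i with toℕ i <? toℕ y
... | yes i<y = inj₁ (i<y , below y i i<y)
  where
  below : ∀ {m} (y : Fin (suc m)) (i : Fin m) → toℕ i < toℕ y → toℕ (punchIn y i) ≡ toℕ i
  below (Fin.suc y) Fin.zero _ = refl
  below (Fin.suc y) (Fin.suc i) i<y = cong suc (below y i (s<s⁻¹ i<y))
... | no i≮y = inj₂ (≮⇒≥ i≮y , above y i (≮⇒≥ i≮y))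
  where
  above : ∀ {m} (y : Fin (suc m)) (i : Fin m) → toℕ y ≤ toℕ i → toℕ (punchIn y i) ≡ suc (toℕ i)
  above Fin.zero i _ = refl
  above (Fin.suc y) (Fin.suc i) y≤i = cong suc (above y i (s≤s⁻¹ y≤i))

-- Inserting a vertex at position r + k turns the pairs {a, r + a}, a < k, into those with a < k + 1.
HalfPair-shift-r+k : ∀ {r k a b a′ b′} → ShiftedPast (r + k) a a′ → ShiftedPast (r + k) b b′ →
                     HalfPair r k a b ⇔ HalfPair r (suc k) a′ b′
HalfPair-shift-r+k {r} {k} sa sb = mk⇔ (shift sa sb) (unshift sa sb)
  where
  shift : ∀ {a b a′ b′} → ShiftedPast (r + k) a a′ → ShiftedPast (r + k) b b′ →
          HalfPair r k a b → HalfPair r (suc k) a′ b′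
  shift (inj₂ (r+k≤a , _)) _ (_ , a<k) = ⊥-elim (<-irrefl refl (<-≤-trans a<k (≤-trans (m≤n+m k r) r+k≤a)))
  shift (inj₁ (_ , refl)) (inj₁ (_ , refl)) (b≡r+a , a<k) = b≡r+a , m<n⇒m<1+n a<k
  shift (inj₁ (_ , refl)) (inj₂ (r+k≤b , _)) (refl , a<k) =
    ⊥-elim (<-irrefl refl (<-≤-trans (+-monoʳ-< r a<k) r+k≤b))

  unshift : ∀ {a b a′ b′} → ShiftedPast (r + k) a a′ → ShiftedPast (r + k) b b′ →
            HalfPair r (suc k) a′ b′ → HalfPair r k a b
  unshift (inj₂ (r+k≤a , refl)) _ (_ , a′<1+k) =
    ⊥-elim (<-irrefl refl (<-≤-trans (s≤s⁻¹ a′<1+k) (≤-trans (m≤n+m k r) r+k≤a)))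
  unshift (inj₁ (_ , refl)) (inj₁ (b<r+k , refl)) (b≡r+a , _) =
    b≡r+a , +-cancelˡ-< r _ _ (subst (_< r + k) b≡r+a b<r+k)
  unshift (inj₁ (_ , refl)) (inj₂ (r+k≤b , refl)) (b′≡r+a , a<1+k) =
    ⊥-elim (<-irrefl refl (<-≤-trans (s≤s r+k≤b) (subst (_≤ r + k) (sym b′≡r+a) (+-monoʳ-≤ r (s≤s⁻¹ a<1+k)))))

-- Inserting a vertex at position k (with k ≤ r) turns the pairs {a, r + a} into the pairs {a, r + 1 + a}.
HalfPair-shift-k : ∀ {r k a b a′ b′} → k ≤ r → ShiftedPast k a a′ → ShiftedPast k b b′ →
                   HalfPair r k a b ⇔ HalfPair (suc r) (suc k) a′ b′
HalfPair-shift-k {r} {k} k≤r sa sb = mk⇔ (shift sa sb) (unshift sa sb)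
  where
  shift : ∀ {a b a′ b′} → ShiftedPast k a a′ → ShiftedPast k b b′ →
          HalfPair r k a b → HalfPair (suc r) (suc k) a′ b′
  shift (inj₂ (k≤a , _)) _ (_ , a<k) = ⊥-elim (<-irrefl refl (<-≤-trans a<k k≤a))
  shift {a} (inj₁ (_ , refl)) (inj₁ (b<k , _)) (refl , _) =
    ⊥-elim (<-irrefl refl (<-≤-trans b<k (≤-trans k≤r (m≤m+n r a))))
  shift (inj₁ (_ , refl)) (inj₂ (_ , refl)) (refl , a<k) = refl , m<n⇒m<1+n a<k

  unshift : ∀ {a b a′ b′} → ShiftedPast k a a′ → ShiftedPast k b b′ →
            HalfPair (suc r) (suc k) a′ b′ → HalfPair r k a b
  unshift (inj₂ (k≤a , refl)) _ (_ , a′<1+k) = ⊥-elim (<-irrefl refl (<-≤-trans (s≤s⁻¹ a′<1+k) k≤a))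
  unshift {a} (inj₁ (_ , refl)) (inj₁ (b<k , refl)) (b≡1+r+a , _) =
    ⊥-elim (<-irrefl refl (<-≤-trans b<k (subst (k ≤_) (sym b≡1+r+a)
                                                 (≤-trans k≤r (≤-trans (n≤1+n r) (m≤m+n (suc r) a))))))
  unshift (inj₁ (a<k , refl)) (inj₂ (_ , refl)) (1+b≡1+r+a , _) = suc-injective 1+b≡1+r+a , a<k

MinusPairs-punchIn : ∀ {n r₁ k₁ r₂ k₂ Y} (y : Fin (suc n)) → toℕ y ≡ Y →
  (∀ {a b a′ b′} → ShiftedPast Y a a′ → ShiftedPast Y b b′ → HalfPair r₁ k₁ a b ⇔ HalfPair r₂ k₂ a′ b′) →
  ∀ i j → MinusPairs n r₁ k₁ i j ⇔ MinusPairs (suc n) r₂ k₂ (punchIn y i) (punchIn y j)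
MinusPairs-punchIn {r₁ = r₁} {k₁} {r₂} {k₂} y refl half⇔ i j =
  mk⇔ (λ (i≢j , ¬paired) → distinct⇔ i≢j , ¬paired ∘ from paired⇔)
      (λ (i≢j , ¬paired) → i≢j ∘ cong toℕ ∘ cong (punchIn y) ∘ toℕ-injective , ¬paired ∘ to paired⇔)
  where
  distinct⇔ : toℕ i ≢ toℕ j → toℕ (punchIn y i) ≢ toℕ (punchIn y j)
  distinct⇔ i≢j = i≢j ∘ cong toℕ ∘ punchIn-injective y i j ∘ toℕ-injective
  paired⇔ : Paired r₁ k₁ (toℕ i) (toℕ j) ⇔ Paired r₂ k₂ (toℕ (punchIn y i)) (toℕ (punchIn y j))
  paired⇔ = half⇔ (ShiftedPast-punchIn y i) (ShiftedPast-punchIn y j)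
        ⊎-⇔ half⇔ (ShiftedPast-punchIn y j) (ShiftedPast-punchIn y i)

module NextPair {n r k : ℕ} (k<r : k < r) (r+1+k≤n : r + suc k ≤ n) where

  0<r : 0 < r
  0<r = ≤-<-trans z≤n k<r

  r+k<n : r + k < n
  r+k<n = subst (_≤ n) (+-suc r k) r+1+k≤n

  X : Fin n
  X = fromℕ< (<-trans (k<r+k 0<r) r+k<n)

  Y : Fin n
  Y = fromℕ< r+k<n

  toℕ-X : toℕ X ≡ k
  toℕ-X = toℕ-fromℕ< _

  toℕ-Y : toℕ Y ≡ r + k
  toℕ-Y = toℕ-fromℕ< r+k<n

  ≡X : ∀ {v} → toℕ v ≡ k → v ≡ X
  ≡X v≡k = toℕ-injective (trans v≡k (sym toℕ-X))

  ≡Y : ∀ {v} → toℕ v ≡ r + k → v ≡ Y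
  ≡Y v≡r+k = toℕ-injective (trans v≡r+k (sym toℕ-Y))

  ≢Y : ∀ {v} → toℕ v ≢ r + k → v ≢ Y
  ≢Y v≢r+k v≡Y = v≢r+k (trans (cong toℕ v≡Y) toℕ-Y)

  ≢X : ∀ {v} → toℕ v ≡ r + k → v ≢ X
  ≢X v≡r+k v≡X = <-irrefl (trans (sym toℕ-X) (trans (cong toℕ (sym v≡X)) v≡r+k)) (k<r+k 0<r)

  Paired-XY : Paired r (suc k) (toℕ X) (toℕ Y)
  Paired-XY = inj₁ (trans toℕ-Y (cong (λ v → r + v) (sym toℕ-X)) , subst (_< suc k) (sym toℕ-X) ≤-refl)

  twins : NonAdjacentTwins (MinusPairs n r (suc k)) X Y
  twins = record
    { twins-distinct = λ Y≡X → <-irrefl (trans (sym toℕ-X) (trans (cong toℕ (sym Y≡X)) toℕ-Y)) (k<r+k 0<r)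
    ; non-adjacent   = λ (_ , ¬paired) → ¬paired Paired-XY
    ; x~⇒y~          = λ (X≢z , ¬paired) →
        (λ Y≡z → ¬paired (subst (Paired r (suc k) (toℕ X)) Y≡z Paired-XY)) ,
        (λ paired → X≢z (trans toℕ-X (sym (Paired-new-y 0<r (subst (λ v → Paired r (suc k) v _) toℕ-Y paired)))))
    ; y~⇒x~          = λ (Y≢z , ¬paired) →
        (λ X≡z → ¬paired (subst (Paired r (suc k) (toℕ Y)) X≡z (Sum.swap Paired-XY))) ,
        (λ paired → Y≢z (trans toℕ-Y (sym (Paired-new-x k<r (subst (λ v → Paired r (suc k) v _) toℕ-X paired)))))
    }

  MinusPairs⇔+XY : ∀ i j → MinusPairs n r k i j ⇔
                   (MinusPairs n r (suc k) i j ⊎ ((i ≡ X × j ≡ Y) ⊎ (i ≡ Y × j ≡ X)))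
  MinusPairs⇔+XY i j = mk⇔ split join
    where
    adjacent-XY : MinusPairs n r k X Y
    adjacent-XY = (λ X≡Y → <-irrefl (trans (sym toℕ-X) (trans X≡Y toℕ-Y)) (k<r+k 0<r)) ,
                  (¬Paired-new 0<r ∘ subst₂ (Paired r k) toℕ-X toℕ-Y)

    split : MinusPairs n r k i j → MinusPairs n r (suc k) i j ⊎ ((i ≡ X × j ≡ Y) ⊎ (i ≡ Y × j ≡ X))
    split (i≢j , ¬paired) with Paired? r (suc k) (toℕ i) (toℕ j)
    ... | no ¬paired′ = inj₁ (i≢j , ¬paired′)
    ... | yes paired with Paired-suc⁻ paired
    ...   | inj₁ paired-k = ⊥-elim (¬paired paired-k)
    ...   | inj₂ (inj₁ (i≡k , j≡r+k)) = inj₂ (inj₁ (≡X i≡k , ≡Y j≡r+k))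
    ...   | inj₂ (inj₂ (i≡r+k , j≡k)) = inj₂ (inj₂ (≡Y i≡r+k , ≡X j≡k))

    join : MinusPairs n r (suc k) i j ⊎ ((i ≡ X × j ≡ Y) ⊎ (i ≡ Y × j ≡ X)) → MinusPairs n r k i j
    join (inj₁ (i≢j , ¬paired)) = i≢j , ¬paired ∘ Paired-suc
    join (inj₂ (inj₁ (refl , refl))) = adjacent-XY
    join (inj₂ (inj₂ (refl , refl))) = MinusPairs-sym adjacent-XY

  MinusPairs⇔+YX : ∀ i j → MinusPairs n r k i j ⇔
                   (MinusPairs n r (suc k) i j ⊎ ((i ≡ Y × j ≡ X) ⊎ (i ≡ X × j ≡ Y)))
  MinusPairs⇔+YX i j =
    mk⇔ (Sum.map₂ Sum.swap ∘ to (MinusPairs⇔+XY i j)) (from (MinusPairs⇔+XY i j) ∘ Sum.map₂ Sum.swap)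

m+n≡o⇒m≡o-n : ∀ {m n o} → m + n ≡ o → + m ≡ + o - + n
m+n≡o⇒m≡o-n {m} {n} refl =
  sym (trans (ℤ.m-n≡m⊖n (m + n) n) (trans (ℤ.⊖-≥ (m≤n+m n m)) (cong +_ (m+n∸n≡m m n))))

UniqueSinkCount : (n : ℕ) → Graph n → Fin n → ℤ → Set
UniqueSinkCount n G s v = Σ ℕ λ m → HasCount (UniqueSinkAO G s) m × + m ≡ v

count-by-deletion : ∀ {n r k r′} {x y : Fin (suc n)} (twins : NonAdjacentTwins (MinusPairs (suc n) r (suc k)) x y) →
  (let open Twins MinusPairs-irrefl MinusPairs-sym twins) →
  (∀ i j → MinusPairs (suc n) r k i j ⇔ G+xy i j) → (∀ i j → MinusPairs n r′ k i j ⇔ G-y i j) →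
  ∀ {s} (s≢y : s ≢ y) → UniqueSinkCount (suc n) (MinusPairs (suc n) r k) s (δ^ k a (suc n)) →
  (∀ s′ → UniqueSinkCount n (MinusPairs n r′ k) s′ (δ^ k a n)) →
  UniqueSinkCount (suc n) (MinusPairs (suc n) r (suc k)) s (δ^ (suc k) a (suc n))
count-by-deletion twins ⇔G+xy ⇔G-y s≢y (m₁ , count+xy , m₁≡) count-smaller
  with count-smaller (Twins.s′ MinusPairs-irrefl MinusPairs-sym twins s≢y)
... | m₂ , count-y , m₂≡
  with Twins.deletion-contraction MinusPairs-irrefl MinusPairs-sym twins s≢y
         (HasCount-cong (UniqueSinkAO-cong ⇔G+xy) count+xy) (HasCount-cong (UniqueSinkAO-cong ⇔G-y) count-y)
... | m , count , m+m₂≡m₁ = m , count , trans (m+n≡o⇒m≡o-n m+m₂≡m₁) (cong₂ _-_ m₁≡ m₂≡)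

count-MinusPairs : ∀ k r n → k ≤ r → r + k ≤ n → ∀ s → UniqueSinkCount n (MinusPairs n r k) s (δ^ k a n)
count-MinusPairs zero r (suc n) _ _ s =
  n ! , HasCount-cong (UniqueSinkAO-cong (λ i j → ⇔-sym (MinusPairs₀⇔Complete i j))) (count-complete n s) , refl
count-MinusPairs (suc k) r@(suc r′) (suc n) 1+k≤r r+1+k≤1+n s
  with count-MinusPairs k r (suc n) (<⇒≤ 1+k≤r) (≤-trans (+-monoʳ-≤ r (n≤1+n k)) r+1+k≤1+n) s
     | toℕ s ℕ.≟ r + k
... | count+xy | no s≢r+k =
  count-by-deletion twins MinusPairs⇔+XY (MinusPairs-punchIn Y toℕ-Y HalfPair-shift-r+k) (≢Y s≢r+k) count+xy
    (count-MinusPairs k r n (<⇒≤ 1+k≤r) (s≤s⁻¹ r+k<n))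
  where open NextPair 1+k≤r r+1+k≤1+n
... | count+xy | yes s≡r+k =
  count-by-deletion (NonAdjacentTwins-swap MinusPairs-sym twins) MinusPairs⇔+YX
    (MinusPairs-punchIn X toℕ-X (HalfPair-shift-k (s≤s⁻¹ 1+k≤r))) (≢X s≡r+k) count+xy
    (count-MinusPairs k r′ n (s≤s⁻¹ 1+k≤r) (≤-trans (+-monoʳ-≤ r′ (n≤1+n k)) (s≤s⁻¹ r+1+k≤1+n)))
  where open NextPair 1+k≤r r+1+k≤1+n

-- Turán graphs

module _ {r : ℕ} .{{_ : NonZero r}} where

  r+c%r : ∀ {c} → c < r → (r + c) % r ≡ c
  r+c%r {c} c<r = trans (cong (_% r) (+-comm r c)) (trans ([m+n]%n≡m%n c r) (m<n⇒m%n≡m c<r))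

  Paired⇒≡mod : ∀ {k a b} → Paired r k a b → a % r ≡ b % r
  Paired⇒≡mod {a = a} (inj₁ (refl , _)) = sym (trans (cong (_% r) (+-comm r a)) ([m+n]%n≡m%n a r))
  Paired⇒≡mod {b = b} (inj₂ (refl , _)) = trans (cong (_% r) (+-comm r b)) ([m+n]%n≡m%n b r)

  module _ {k : ℕ} (k≤r : k ≤ r) where

    private
      below-or-above-r : ∀ {a} → a < r + k → a < r ⊎ ∃ λ c → a ≡ r + c × c < k
      below-or-above-r {a} a<r+k with a <? r
      ... | yes a<r = inj₁ a<r
      ... | no a≮r = inj₂ (a ∸ r , a≡r+c , +-cancelˡ-< r _ _ (subst (_< r + k) a≡r+c a<r+k))
        where
        a≡r+c = sym (m+[n∸m]≡n (≮⇒≥ a≮r))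

      r+c%r′ : ∀ {c} → c < k → (r + c) % r ≡ c
      r+c%r′ c<k = r+c%r (<-≤-trans c<k k≤r)

    ≡mod⇒≡⊎Paired : ∀ {a b} → a < r + k → b < r + k → a % r ≡ b % r → a ≡ b ⊎ Paired r k a b
    ≡mod⇒≡⊎Paired {a} {b} a<r+k b<r+k a≡b with below-or-above-r a<r+k | below-or-above-r b<r+k
    ... | inj₁ a<r | inj₁ b<r = inj₁ (trans (sym (m<n⇒m%n≡m a<r)) (trans a≡b (m<n⇒m%n≡m b<r)))
    ... | inj₁ a<r | inj₂ (c , refl , c<k) =
          let a≡c = trans (sym (m<n⇒m%n≡m a<r)) (trans a≡b (r+c%r′ c<k))
          in inj₂ (inj₁ (cong (λ v → r + v) (sym a≡c) , subst (_< k) (sym a≡c) c<k))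
    ... | inj₂ (c , refl , c<k) | inj₁ b<r =
          let c≡b = trans (sym (r+c%r′ c<k)) (trans a≡b (m<n⇒m%n≡m b<r))
          in inj₂ (inj₂ (cong (λ v → r + v) c≡b , subst (_< k) c≡b c<k))
    ... | inj₂ (c , refl , c<k) | inj₂ (c′ , refl , c′<k) =
          inj₁ (cong (λ v → r + v) (trans (sym (r+c%r′ c<k)) (trans a≡b (r+c%r′ c′<k))))

    TuranAdj⇔MinusPairs : ∀ i j → TuranAdj (r + k) r i j ⇔ MinusPairs (r + k) r k i j
    TuranAdj⇔MinusPairs i j = mk⇔
      (λ i≢j → i≢j ∘ cong (_% r) , i≢j ∘ Paired⇒≡mod)
      (λ (i≢j , ¬paired) i≡j → [ i≢j , ¬paired ]′ (≡mod⇒≡⊎Paired (toℕ<n i) (toℕ<n j) i≡j))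

count-Turán : ∀ k r .{{_ : NonZero r}} → k ≤ r → Σ ℕ λ m → IsU (r + k) r m × + m ≡ δ^ k a (r + k)
count-Turán k r@(suc _) k≤r with count-MinusPairs k r (r + k) k≤r ≤-refl zero
... | m , _ , m≡ = m , IsU-m , m≡
  where
  IsU-m : IsU (r + k) r m
  IsU-m s with count-MinusPairs k r (r + k) k≤r ≤-refl s
  ... | mₛ , count , mₛ≡ =
    subst (HasCount _) (ℤ.+-injective (trans mₛ≡ (sym m≡)))
      (HasCount-cong (UniqueSinkAO-cong λ i j → ⇔-sym (TuranAdj⇔MinusPairs k≤r i j)) count)

Turán-recurrence : ∀ k r′ → let r = suc r′; n = r + suc k in suc k ≤ r →
  Σ ℕ λ m₁ → Σ ℕ λ m₂ → Σ ℕ λ m₃ →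
    IsU n r m₁ × IsU n (suc r) m₂ × IsU (n ∸ 1) r m₃ × (+ m₁ ≡ + m₂ - + m₃)
Turán-recurrence k r′ 1+k≤r =
  let m₁ , u₁ , m₁≡ = count-Turán (suc k) (suc r′) 1+k≤r
      m₂ , u₂ , m₂≡ = count-Turán k (suc (suc r′)) (≤-trans (n≤1+n k) (≤-trans 1+k≤r (n≤1+n (suc r′))))
      m₃ , u₃ , m₃≡ = count-Turán k (suc r′) (≤-trans (n≤1+n k) 1+k≤r)
  in m₁ , m₂ , m₃ , u₁ , subst (λ n → IsU n (suc (suc r′)) m₂) n≡ u₂ , subst (λ n → IsU n (suc r′) m₃) n-1≡ u₃ ,
     (begin
       + m₁                                           ≡⟨ m₁≡ ⟩
       δ^ k a (suc r′ + suc k) - δ^ k a (r′ + suc k)  ≡⟨ sym (cong₂ _-_ (cong (δ^ k a) n≡) (cong (δ^ k a) n-1≡)) ⟩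
       δ^ k a (suc (suc r′) + k) - δ^ k a (suc r′ + k) ≡⟨ sym (cong₂ _-_ m₂≡ m₃≡) ⟩
       + m₂ - + m₃                                    ∎)
  where
  n≡ : suc (suc r′) + k ≡ suc r′ + suc k
  n≡ = sym (+-suc (suc r′) k)
  n-1≡ : suc r′ + k ≡ r′ + suc k
  n-1≡ = sym (+-suc r′ k)

theorem7p1 : (k r : ℕ) .{{_ : NonZero r}} → k ≤ r →
    (Σ ℕ λ m → IsU (r + k) r m × (+ m ≡ δ^ k a (r + k))) ×
    (1 ≤ k →
      Σ ℕ λ m₁ → Σ ℕ λ m₂ → Σ ℕ λ m₃ →
        IsU (r + k) r m₁ × IsU (r + k) (suc r) m₂ × IsU (r + k ∸ 1) r m₃ ×
        (+ m₁ ≡ + m₂ - + m₃))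
theorem7p1 zero r k≤r = count-Turán zero r k≤r , λ ()
theorem7p1 (suc k) (suc r′) k≤r = count-Turán (suc k) (suc r′) k≤r , λ _ → Turán-recurrence k r′ k≤r
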